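{- Let $M_1,M_2$ be matroids of positive rank on disjoint ground sets $S_1,S_2$, let $S'_1\subseteq S_1$, $S'_2\subseteq S_2$, let $T_1,T_2$ be sets such that $T_1,T_2,S_1\cup S_2$ are pairwise disjoint, let $k$ be an integer with $|T_1|=k-r(M_1)-|S'_2|$ and $|T_2|=k-r(M_2)-|S'_1|$, and let $j=|S_1|+|S_2|+|T_1|+|T_2|-k$. Then $$j\ge r(M_1^*)+\eta_{M_1^*}(S_1-S'_1)+r(M_2^*)+\eta_{M_2^*}(S_2-S'_2)$$ if and only if $k\ge r(M_1)+\eta_{M_1}(S'_1)+r(M_2)+\eta_{M_2}(S'_2)$. Moreover, when these inequalities hold, $$\bigl(M_k(M_1,S'_1,T_1;M_2,S'_2,T_2)\bigr)^*=M_j(M_1^*,S_1-S'_1,T_2;M_2^*,S_2-S'_2,T_1).$$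
   Context: All matroids are finite. A cyclic flat is a flat that is a (possibly empty) union of circuits; for a matroid $N$, $\mathcal{Z}'(N)$ denotes its set of nonempty proper cyclic flats, and $\eta_N(Y)=|Y|-r_N(Y)$ is the nullity. A matroid is determined by its cyclic flats and their ranks. Construction $M_k(N_1,A_1,U_1;N_2,A_2,U_2)$: let $N_1,N_2$ be matroids of positive rank on disjoint ground sets $R_1,R_2$ with rank functions $\rho_1,\rho_2$; let $A_1\subseteq R_1$, $A_2\subseteq R_2$; let $k$ be an integer with $k\ge r(N_1)+\eta_{N_1}(A_1)+r(N_2)+\eta_{N_2}(A_2)$; and let $U_1,U_2$ be sets with $|U_1|=k-r(N_1)-|A_2|$, $|U_2|=k-r(N_2)-|A_1|$, such that $U_1,U_2,R_1\cup R_2$ are pairwise disjoint. Let $E=R_1\cup R_2\cup U_1\cup U_2$. Then $M_k(N_1,A_1,U_1;N_2,A_2,U_2)$ is the (existing and unique) matroid on $E$ whose cyclic flats are exactly: $\emptyset$, of rank $0$; $E$, of rank $k$; the sets $F\cup U_1\cup A_2$ for $F\in\mathcal{Z}'(N_1)$, of rank $\rho_1(F)+|U_1|+|A_2|$; and the sets $F\cup U_2\cup A_1$ for $F\in\mathcal{Z}'(N_2)$, of rank $\rho_2(F)+|U_2|+|A_1|$. -}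

module Defs where

open import Data.Nat using (ℕ; zero; suc; _+_; _∸_; _≤_; _<_)
open import Data.Fin using (Fin)
open import Data.Fin.Subset
  using (Subset; _∈_; _∉_; _⊆_; _⊂_; _∪_; _∩_; _─_; ∣_∣; ⁅_⁆; Nonempty; Empty)
  renaming (⊥ to ∅)
open import Data.Integer as ℤ using (ℤ; +_)
open import Data.Product using (Σ; ∃; _×_; _,_)
open import Data.Sum using (_⊎_)
open import Relation.Nullary using (¬_)
open import Relation.Binary.PropositionalEquality using (_≡_)

-- All ground sets live inside a common finite universe Fin n.
-- Only the values of rk on subsets of the ground set are meaningful.
record RankFn (n : ℕ) : Set where
  constructor mkRankFn
  field
    ground : Subset n
    rk     : Subset n → ℕ
open RankFn public

record IsMatroid {n : ℕ} (M : RankFn n) : Set where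
  field
    R1 : ∀ X → X ⊆ ground M → rk M X ≤ ∣ X ∣
    R2 : ∀ X Y → Y ⊆ ground M → X ⊆ Y → rk M X ≤ rk M Y
    R3 : ∀ X Y → X ⊆ ground M → Y ⊆ ground M →
         rk M (X ∪ Y) + rk M (X ∩ Y) ≤ rk M X + rk M Y

Disjoint : ∀ {n} → Subset n → Subset n → Set
Disjoint A B = Empty (A ∩ B)

module _ {n : ℕ} (M : RankFn n) where

  r : ℕ
  r = rk M (ground M)

  η : Subset n → ℕ
  η Y = ∣ Y ∣ ∸ rk M Y

  Circuit : Subset n → Set
  Circuit C = C ⊆ ground M × rk M C < ∣ C ∣ ×
              (∀ Y → Y ⊂ C → rk M Y ≡ ∣ Y ∣)

  Flat : Subset n → Set
  Flat X = X ⊆ ground M ×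
           (∀ e → e ∈ ground M → e ∉ X → rk M X < rk M (X ∪ ⁅ e ⁆))

  UnionOfCircuits : Subset n → Set
  UnionOfCircuits X = ∀ e → e ∈ X → ∃ λ C → Circuit C × C ⊆ X × e ∈ C

  CyclicFlat : Subset n → Set
  CyclicFlat X = Flat X × UnionOfCircuits X

  NPCyclicFlat : Subset n → Set
  NPCyclicFlat X = CyclicFlat X × Nonempty X × ¬ (X ≡ ground M)

dual : ∀ {n} → RankFn n → RankFn n
dual M = mkRankFn (ground M)
  (λ X → (∣ X ∣ + rk M (ground M ─ X)) ∸ rk M (ground M))

-- "M is the matroid M_k(N₁,A₁,U₁;N₂,A₂,U₂)": its ground set is
-- E = R₁ ∪ R₂ ∪ U₁ ∪ U₂ and its cyclic flats (with ranks) are exactly those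
-- listed in the construction.  (Such a matroid exists and is unique.)
IsMk : ∀ {n} → (k : ℤ) → (N₁ : RankFn n) (A₁ U₁ : Subset n)
       (N₂ : RankFn n) (A₂ U₂ : Subset n) → RankFn n → Set
IsMk {n} k N₁ A₁ U₁ N₂ A₂ U₂ M =
  ground M ≡ E ×
  (∀ X → CyclicFlat M X →
     X ≡ ∅ ⊎ X ≡ E ⊎
     (∃ λ F → NPCyclicFlat N₁ F × X ≡ F ∪ U₁ ∪ A₂) ⊎
     (∃ λ F → NPCyclicFlat N₂ F × X ≡ F ∪ U₂ ∪ A₁)) ×
  (CyclicFlat M ∅ × rk M ∅ ≡ 0) ×
  (CyclicFlat M E × + (rk M E) ≡ k) ×
  (∀ F → NPCyclicFlat N₁ F →
     CyclicFlat M (F ∪ U₁ ∪ A₂) ×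
     rk M (F ∪ U₁ ∪ A₂) ≡ rk N₁ F + ∣ U₁ ∣ + ∣ A₂ ∣) ×
  (∀ F → NPCyclicFlat N₂ F →
     CyclicFlat M (F ∪ U₂ ∪ A₁) ×
     rk M (F ∪ U₂ ∪ A₁) ≡ rk N₂ F + ∣ U₂ ∣ + ∣ A₁ ∣)
  where
  E : Subset n
  E = ground N₁ ∪ ground N₂ ∪ U₁ ∪ U₂

module Submission where

-- Everything rests on the classical fact that complementation E − _ maps the
-- cyclic flats of M bijectively onto those of M*, with
-- r*(E − X) = |E − X| + r(X) − r(M).  A
-- cyclic flat is a subset X of E that is *closed* (adding any e ∉ X raises
-- the rank) and *cyclic* (removing any e ∈ X keeps the rank; module
-- MatroidRank shows this is the same as being a union of circuits), and the
-- exchange identities of module Duality show that X is closed in M iff E − X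
-- is cyclic in M*, and X is cyclic in M iff E − X is closed in M*.
--
-- The two bounds are
-- equivalent because they have the same slack over ℤ, as
-- r(M*) + η*(S − S') = |S| − r(S') and r(M) + η(S') = r(M) + |S'| − r(S').
-- For the duality, complementation maps the cyclic flats ∅, E, F ∪ T₁ ∪ S₂',
-- F ∪ T₂ ∪ S₁' listed for M_k onto E, ∅, (S₁ − F) ∪ T₂ ∪ (S₂ − S₂'),
-- (S₂ − F) ∪ T₁ ∪ (S₁ − S₁'), which are the sets listed for M_j (module
-- ConstructionDuality treats one half, the other is symmetric), and the dual
-- rank formula turns the listed ranks into each other.

open import Data.Nat using (ℕ)
open import Defs

-- Identities in the Boolean algebra of subsets of Fin n, possibly under
-- hypotheses that are themselves such identities, are decided by truth
-- tables: sets are equal iff they agree at every element, and at a single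
-- element a set expression is a Boolean function of the memberships of its
-- variables.
module SubsetSolver where

  open import Data.Nat using (ℕ; zero; suc)
  open import Data.Bool using (Bool; true; false; _∧_; _∨_; not; T)
  open import Data.Bool.Properties using (∧-zeroʳ; ∧-identityʳ; T-∧)
  open import Data.Fin using (Fin; zero; suc)
  open import Data.Vec using (Vec; []; _∷_; lookup; map)
  open import Data.Vec.Properties
    using (lookup-zipWith; lookup-replicate; lookup-map; tabulate∘lookup; tabulate-cong)
  open import Data.Fin.Subset using (Subset; _∪_; _∩_; _─_) renaming (⊥ to ∅)
  open import Data.List using (List; []; _∷_)
  open import Data.Product using (_×_; _,_; proj₁; proj₂)
  open import Data.Unit using (⊤)
  open import Function.Bundles using (Equivalence)
  open import Relation.Binary.PropositionalEquality using (_≡_; refl; sym; trans; cong₂; subst)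

  infixr 6 _∪'_
  infixr 7 _∩'_
  infixl 5 _─'_

  data Expr (k : ℕ) : Set where
    var            : Fin k → Expr k
    ∅'             : Expr k
    _∪'_ _∩'_ _─'_ : Expr k → Expr k → Expr k

  ⟦_⟧ : ∀ {k n} → Expr k → Vec (Subset n) k → Subset n
  ⟦ var i ⟧  env = lookup env i
  ⟦ ∅' ⟧     env = ∅
  ⟦ a ∪' b ⟧ env = ⟦ a ⟧ env ∪ ⟦ b ⟧ env
  ⟦ a ∩' b ⟧ env = ⟦ a ⟧ env ∩ ⟦ b ⟧ env
  ⟦ a ─' b ⟧ env = ⟦ a ⟧ env ─ ⟦ b ⟧ env

  ⟦_⟧ᵇ : ∀ {k} → Expr k → Vec Bool k → Bool
  ⟦ var i ⟧ᵇ  β = lookup β i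
  ⟦ ∅' ⟧ᵇ     β = false
  ⟦ a ∪' b ⟧ᵇ β = ⟦ a ⟧ᵇ β ∨ ⟦ b ⟧ᵇ β
  ⟦ a ∩' b ⟧ᵇ β = ⟦ a ⟧ᵇ β ∧ ⟦ b ⟧ᵇ β
  ⟦ a ─' b ⟧ᵇ β = ⟦ a ⟧ᵇ β ∧ not (⟦ b ⟧ᵇ β)

  column : ∀ {k n} → Vec (Subset n) k → Fin n → Vec Bool k
  column env i = map (λ s → lookup s i) env

  lookup-─ : ∀ {n} (p q : Subset n) i → lookup (p ─ q) i ≡ lookup p i ∧ not (lookup q i)
  lookup-─ (x ∷ p) (true ∷ q)  zero    = sym (∧-zeroʳ x)
  lookup-─ (x ∷ p) (false ∷ q) zero    = sym (∧-identityʳ x)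
  lookup-─ (x ∷ p) (y ∷ q)     (suc i) = lookup-─ p q i

  lookup-⟦⟧ : ∀ {k n} (e : Expr k) (env : Vec (Subset n) k) i →
              lookup (⟦ e ⟧ env) i ≡ ⟦ e ⟧ᵇ (column env i)
  lookup-⟦⟧ (var j)  env i = sym (lookup-map j (λ s → lookup s i) env)
  lookup-⟦⟧ ∅'       env i = lookup-replicate i false
  lookup-⟦⟧ (a ∪' b) env i = trans (lookup-zipWith _∨_ i (⟦ a ⟧ env) (⟦ b ⟧ env))
                                   (cong₂ _∨_ (lookup-⟦⟧ a env i) (lookup-⟦⟧ b env i))
  lookup-⟦⟧ (a ∩' b) env i = trans (lookup-zipWith _∧_ i (⟦ a ⟧ env) (⟦ b ⟧ env))
                                   (cong₂ _∧_ (lookup-⟦⟧ a env i) (lookup-⟦⟧ b env i))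
  lookup-⟦⟧ (a ─' b) env i = trans (lookup-─ (⟦ a ⟧ env) (⟦ b ⟧ env) i)
                                   (cong₂ (λ x y → x ∧ not y) (lookup-⟦⟧ a env i) (lookup-⟦⟧ b env i))

  subset-ext : ∀ {n} {p q : Subset n} → (∀ i → lookup p i ≡ lookup q i) → p ≡ q
  subset-ext {p = p} {q} p≗q = trans (sym (tabulate∘lookup p)) (trans (tabulate-cong p≗q) (tabulate∘lookup q))

  _==_ : Bool → Bool → Bool
  true  == y = y
  false == y = not y

  ==-sound : ∀ x y → T (x == y) → x ≡ y
  ==-sound true  true  _ = refl
  ==-sound false false _ = refl

  ==-complete : ∀ {x y} → x ≡ y → T (x == y)
  ==-complete {true}  refl = _
  ==-complete {false} refl = _

  _implies_ : Bool → Bool → Bool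
  true  implies y = y
  false implies y = true

  modus-ponens : ∀ x y → T (x implies y) → T x → T y
  modus-ponens true y x⇒y _ = x⇒y

  Equations : ℕ → Set
  Equations k = List (Expr k × Expr k)

  Holds : ∀ {k n} → Equations k → Vec (Subset n) k → Set
  Holds []             env = ⊤
  Holds ((a , b) ∷ hs) env = ⟦ a ⟧ env ≡ ⟦ b ⟧ env × Holds hs env

  holdsᵇ : ∀ {k} → Equations k → Vec Bool k → Bool
  holdsᵇ []             β = true
  holdsᵇ ((a , b) ∷ hs) β = (⟦ a ⟧ᵇ β == ⟦ b ⟧ᵇ β) ∧ holdsᵇ hs β

  holds-column : ∀ {k n} (hs : Equations k) (env : Vec (Subset n) k) →
                 Holds hs env → ∀ i → T (holdsᵇ hs (column env i))
  holds-column []             env _          i = _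
  holds-column ((a , b) ∷ hs) env (a≡b , hs✓) i =
    Equivalence.from T-∧
      ( ==-complete (trans (sym (lookup-⟦⟧ a env i))
                    (subst (λ s → lookup s i ≡ ⟦ b ⟧ᵇ (column env i)) (sym a≡b) (lookup-⟦⟧ b env i)))
      , holds-column hs env hs✓ i)

  everywhere : (k : ℕ) → (Vec Bool k → Bool) → Bool
  everywhere zero    f = f []
  everywhere (suc k) f = everywhere k (λ β → f (true ∷ β)) ∧ everywhere k (λ β → f (false ∷ β))

  everywhere-sound : ∀ k f → T (everywhere k f) → ∀ β → T (f β)
  everywhere-sound zero    f ok []          = ok
  everywhere-sound (suc k) f ok (true ∷ β)  = everywhere-sound k _ (Equivalence.to T-∧ ok .proj₁) β
  everywhere-sound (suc k) f ok (false ∷ β) = everywhere-sound k _ (Equivalence.to T-∧ ok .proj₂) β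

  entails : ∀ {k} → Equations k → Expr k → Expr k → Vec Bool k → Bool
  entails hs lhs rhs β = holdsᵇ hs β implies (⟦ lhs ⟧ᵇ β == ⟦ rhs ⟧ᵇ β)

  -- The validity check is an implicit
  -- argument of type ⊤ for a valid table, so it is found by computation.
  prove : ∀ {k n} (hs : Equations k) (lhs rhs : Expr k) → {_ : T (everywhere k (entails hs lhs rhs))} →
          (env : Vec (Subset n) k) → Holds hs env → ⟦ lhs ⟧ env ≡ ⟦ rhs ⟧ env
  prove {k} hs lhs rhs {valid} env hs✓ = subset-ext λ i →
    let β = column env i in
    trans (lookup-⟦⟧ lhs env i)
      (trans (==-sound _ _ (modus-ponens (holdsᵇ hs β) _ (everywhere-sound k _ valid β) (holds-column hs env hs✓ i)))
             (sym (lookup-⟦⟧ rhs env i)))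

module SubsetFacts where

  open import Data.Nat using (suc; _+_)
  open import Data.Nat.Properties using (+-suc; +-comm; +-assoc)
  open import Data.Bool using (true; false; _∧_; not)
  open import Data.Bool.Properties using (∧-zeroʳ)
  open import Data.Fin using (Fin)
  open import Data.Fin.Patterns using (0F; 1F)
  open import Data.Vec using ([]; _∷_; here; lookup)
  open import Data.Vec.Properties using ([]=⇒lookup)
  open import Data.Fin.Subset
    using (Subset; _∈_; _∉_; _⊆_; _∪_; _∩_; _─_; _-_; ∣_∣; ⁅_⁆; Nonempty)
    renaming (⊥ to ∅)
  open import Data.Fin.Subset.Properties
    using ( drop-∷-⊆; Empty-unique; nonempty?; _∈?_; ∉⊥; ∣⁅x⁆∣≡1; x∈⁅y⁆⇒x≡y
          ; x∈p∪q⁻; x∈p∩q⁻; x∈p∧x∉q⇒x∈p─q)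
  open import Data.List using ([]; _∷_)
  open import Data.Product using (_×_; _,_)
  open import Data.Sum using (inj₁; inj₂)
  open import Data.Empty using (⊥-elim)
  open import Relation.Nullary using (yes; no)
  open import Relation.Binary.PropositionalEquality
  open ≡-Reasoning
  open SubsetSolver

  private
    true≢false : true ≢ false
    true≢false ()

  -- Subset hypotheses are passed to the solver as equations p ─ q = ∅.
  ⊆⇒─≡∅ : ∀ {n} {p q : Subset n} → p ⊆ q → p ─ q ≡ ∅
  ⊆⇒─≡∅ {p = []}        {[]}        _   = refl
  ⊆⇒─≡∅ {p = true ∷ p}  {true ∷ q}  p⊆q = cong (false ∷_) (⊆⇒─≡∅ (drop-∷-⊆ p⊆q))
  ⊆⇒─≡∅ {p = false ∷ p} {true ∷ q}  p⊆q = cong (false ∷_) (⊆⇒─≡∅ (drop-∷-⊆ p⊆q))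
  ⊆⇒─≡∅ {p = false ∷ p} {false ∷ q} p⊆q = cong (false ∷_) (⊆⇒─≡∅ (drop-∷-⊆ p⊆q))
  ⊆⇒─≡∅ {p = true ∷ p}  {false ∷ q} p⊆q with p⊆q here
  ... | ()

  ∈─⇒∉ : ∀ {n} (p q : Subset n) {x} → x ∈ p ─ q → x ∉ q
  ∈─⇒∉ p q {x} x∈p─q x∈q = true≢false (begin
    true                          ≡⟨ sym ([]=⇒lookup x∈p─q) ⟩
    lookup (p ─ q) x              ≡⟨ lookup-─ p q x ⟩
    lookup p x ∧ not (lookup q x) ≡⟨ cong (λ b → lookup p x ∧ not b) ([]=⇒lookup x∈q) ⟩
    lookup p x ∧ false            ≡⟨ ∧-zeroʳ (lookup p x) ⟩
    false                         ∎)

  ∈⇒⁅⁆⊆ : ∀ {n} {e : Fin n} {p} → e ∈ p → ⁅ e ⁆ ⊆ p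
  ∈⇒⁅⁆⊆ {e = e} e∈p x∈⁅e⁆ rewrite x∈⁅y⁆⇒x≡y e x∈⁅e⁆ = e∈p

  ∪-⊆ : ∀ {n} {p q s : Subset n} → p ⊆ s → q ⊆ s → p ∪ q ⊆ s
  ∪-⊆ {p = p} {q} p⊆s q⊆s x∈p∪q with x∈p∪q⁻ p q x∈p∪q
  ... | inj₁ x∈p = p⊆s x∈p
  ... | inj₂ x∈q = q⊆s x∈q

  card-split : ∀ {n} (p q : Subset n) → ∣ p ∣ ≡ ∣ p ∩ q ∣ + ∣ p ─ q ∣
  card-split []          []          = refl
  card-split (true ∷ p)  (true ∷ q)  = cong suc (card-split p q)
  card-split (true ∷ p)  (false ∷ q) = trans (cong suc (card-split p q)) (sym (+-suc _ _))
  card-split (false ∷ p) (true ∷ q)  = card-split p q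
  card-split (false ∷ p) (false ∷ q) = card-split p q

  card-∪-disjoint : ∀ {n} (p q : Subset n) → p ∩ q ≡ ∅ → ∣ p ∪ q ∣ ≡ ∣ p ∣ + ∣ q ∣
  card-∪-disjoint p q p∩q≡∅ = begin
    ∣ p ∪ q ∣                         ≡⟨ card-split (p ∪ q) p ⟩
    ∣ (p ∪ q) ∩ p ∣ + ∣ (p ∪ q) ─ p ∣ ≡⟨ cong₂ (λ a b → ∣ a ∣ + ∣ b ∣) p∪q∩p p∪q─p ⟩
    ∣ p ∣ + ∣ q ∣                     ∎
    where
    p∪q∩p : (p ∪ q) ∩ p ≡ p
    p∪q∩p = prove [] ((var 0F ∪' var 1F) ∩' var 0F) (var 0F) (p ∷ q ∷ []) _
    p∪q─p : (p ∪ q) ─ p ≡ q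
    p∪q─p = prove ((var 0F ∩' var 1F , ∅') ∷ []) ((var 0F ∪' var 1F) ─' var 0F) (var 1F)
              (p ∷ q ∷ []) (p∩q≡∅ , _)

  card-∪∩ : ∀ {n} (p q : Subset n) → ∣ p ∪ q ∣ + ∣ p ∩ q ∣ ≡ ∣ p ∣ + ∣ q ∣
  card-∪∩ p q = begin
    ∣ p ∪ q ∣ + ∣ p ∩ q ∣                   ≡⟨ cong (λ s → ∣ s ∣ + ∣ p ∩ q ∣) p∪q≡p∪[q─p] ⟩
    ∣ p ∪ (q ─ p) ∣ + ∣ p ∩ q ∣             ≡⟨ cong (_+ ∣ p ∩ q ∣) (card-∪-disjoint p (q ─ p) p∩[q─p]≡∅) ⟩
    (∣ p ∣ + ∣ q ─ p ∣) + ∣ p ∩ q ∣         ≡⟨ +-assoc ∣ p ∣ _ _ ⟩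
    ∣ p ∣ + (∣ q ─ p ∣ + ∣ p ∩ q ∣)         ≡⟨ cong (∣ p ∣ +_) (+-comm ∣ q ─ p ∣ _) ⟩
    ∣ p ∣ + (∣ p ∩ q ∣ + ∣ q ─ p ∣)         ≡⟨ cong (λ s → ∣ p ∣ + (∣ s ∣ + ∣ q ─ p ∣)) p∩q≡q∩p ⟩
    ∣ p ∣ + (∣ q ∩ p ∣ + ∣ q ─ p ∣)         ≡⟨ cong (∣ p ∣ +_) (sym (card-split q p)) ⟩
    ∣ p ∣ + ∣ q ∣                           ∎
    where
    env = p ∷ q ∷ []
    p∪q≡p∪[q─p] : p ∪ q ≡ p ∪ (q ─ p)
    p∪q≡p∪[q─p] = prove [] (var 0F ∪' var 1F) (var 0F ∪' (var 1F ─' var 0F)) env _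
    p∩[q─p]≡∅ : p ∩ (q ─ p) ≡ ∅
    p∩[q─p]≡∅ = prove [] (var 0F ∩' (var 1F ─' var 0F)) ∅' env _
    p∩q≡q∩p : p ∩ q ≡ q ∩ p
    p∩q≡q∩p = prove [] (var 0F ∩' var 1F) (var 1F ∩' var 0F) env _

  card-remove : ∀ {n} {e : Fin n} {p} → e ∈ p → ∣ p ∣ ≡ suc ∣ p - e ∣
  card-remove {e = e} {p} e∈p = begin
    ∣ p ∣                         ≡⟨ card-split p ⁅ e ⁆ ⟩
    ∣ p ∩ ⁅ e ⁆ ∣ + ∣ p - e ∣     ≡⟨ cong (λ s → ∣ s ∣ + ∣ p - e ∣) p∩⁅e⁆≡⁅e⁆ ⟩
    ∣ ⁅ e ⁆ ∣ + ∣ p - e ∣         ≡⟨ cong (_+ ∣ p - e ∣) (∣⁅x⁆∣≡1 e) ⟩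
    suc ∣ p - e ∣                 ∎
    where
    p∩⁅e⁆≡⁅e⁆ : p ∩ ⁅ e ⁆ ≡ ⁅ e ⁆
    p∩⁅e⁆≡⁅e⁆ = prove ((var 1F ─' var 0F , ∅') ∷ []) (var 0F ∩' var 1F) (var 1F)
                  (p ∷ ⁅ e ⁆ ∷ []) (⊆⇒─≡∅ (∈⇒⁅⁆⊆ e∈p) , _)

  card-add : ∀ {n} {e : Fin n} {p} → e ∉ p → ∣ p ∪ ⁅ e ⁆ ∣ ≡ suc ∣ p ∣
  card-add {e = e} {p} e∉p = begin
    ∣ p ∪ ⁅ e ⁆ ∣       ≡⟨ card-∪-disjoint p ⁅ e ⁆ p∩⁅e⁆≡∅ ⟩
    ∣ p ∣ + ∣ ⁅ e ⁆ ∣   ≡⟨ cong (∣ p ∣ +_) (∣⁅x⁆∣≡1 e) ⟩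
    ∣ p ∣ + 1           ≡⟨ +-comm ∣ p ∣ 1 ⟩
    suc ∣ p ∣           ∎
    where
    p∩⁅e⁆≡∅ : p ∩ ⁅ e ⁆ ≡ ∅
    p∩⁅e⁆≡∅ = Empty-unique λ (x , x∈p∩⁅e⁆) → e∉p (e∈p-if-meets x∈p∩⁅e⁆)
      where
      e∈p-if-meets : ∀ {x} → x ∈ p ∩ ⁅ e ⁆ → e ∈ p
      e∈p-if-meets x∈ with x∈p∩q⁻ p ⁅ e ⁆ x∈
      ... | x∈p , x∈⁅e⁆ = subst (_∈ p) (x∈⁅y⁆⇒x≡y e x∈⁅e⁆) x∈p

  complement-involutive : ∀ {n} {E X : Subset n} → X ⊆ E → E ─ (E ─ X) ≡ X
  complement-involutive {E = E} {X} X⊆E =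
    prove ((var 1F ─' var 0F , ∅') ∷ []) (var 0F ─' (var 0F ─' var 1F)) (var 1F) (E ∷ X ∷ []) (⊆⇒─≡∅ X⊆E , _)

  ∉-complement : ∀ {n} {E X : Subset n} {e} → e ∈ E → e ∉ E ─ X → e ∈ X
  ∉-complement {X = X} {e} e∈E e∉E─X with e ∈? X
  ... | yes e∈X = e∈X
  ... | no  e∉X = ⊥-elim (e∉E─X (x∈p∧x∉q⇒x∈p─q e∈E e∉X))

  complement-nonempty-proper : ∀ {n} {S X : Subset n} → X ⊆ S → Nonempty X → X ≢ S →
                               Nonempty (S ─ X) × S ─ X ≢ S
  complement-nonempty-proper {S = S} {X} X⊆S (x , x∈X) X≢S = nonempty , proper
    where
    nonempty : Nonempty (S ─ X)
    nonempty with nonempty? (S ─ X)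
    ... | yes ne = ne
    ... | no  ¬ne = ⊥-elim (X≢S (prove ((var 1F ─' var 0F , ∅') ∷ (var 0F ─' var 1F , ∅') ∷ [])
                                   (var 1F) (var 0F) (S ∷ X ∷ []) (⊆⇒─≡∅ X⊆S , Empty-unique ¬ne , _)))
    proper : S ─ X ≢ S
    proper S─X≡S = ∉⊥ (subst (x ∈_) X≡∅ x∈X)
      where
      X≡∅ : X ≡ ∅
      X≡∅ = prove ((var 1F ─' var 0F , ∅') ∷ (var 0F ─' var 1F , var 0F) ∷ []) (var 1F) ∅'
              (S ∷ X ∷ []) (⊆⇒─≡∅ X⊆S , S─X≡S , _)

  complement-swap : ∀ {n} {E Y Z : Subset n} → Y ⊆ E → E ─ Y ≡ Z → Y ≡ E ─ Z
  complement-swap {E = E} Y⊆E E─Y≡Z = trans (sym (complement-involutive Y⊆E)) (cong (E ─_) E─Y≡Z)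

private
  module RankArithmetic where
    open import Data.Nat using (_+_; _≤_; _<_; suc; s≤s)
    open import Data.Nat.Properties
      using ( +-cancelˡ-≤; +-cancelˡ-≡; +-cancelʳ-≡; +-suc; +-comm; +-monoʳ-≤; suc-injective
            ; +-commutativeSemigroup)
    open import Algebra.Properties.CommutativeSemigroup +-commutativeSemigroup using (xy∙z≈xz∙y)
    open import Relation.Binary.PropositionalEquality using (_≡_; sym; trans; cong)
    open Data.Nat.Properties.≤-Reasoning

    ≤-from-sum : ∀ {a b c d} → a + b ≤ c + d → d ≤ a → b ≤ c
    ≤-from-sum {a} {b} {c} {d} a+b≤c+d d≤a = +-cancelˡ-≤ a b c (begin
      a + b ≤⟨ a+b≤c+d ⟩
      c + d ≤⟨ +-monoʳ-≤ c d≤a ⟩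
      c + a ≡⟨ +-comm c a ⟩
      a + c ∎)

    <-from-sum : ∀ {a b c d} → a + b ≤ c + d → d < a → b < c
    <-from-sum {a} {b} {c} {d} a+b≤c+d d<a = +-cancelˡ-≤ a (suc b) c (begin
      a + suc b   ≡⟨ +-suc a b ⟩
      suc (a + b) ≤⟨ s≤s a+b≤c+d ⟩
      suc (c + d) ≡⟨ sym (+-suc c d) ⟩
      c + suc d   ≤⟨ +-monoʳ-≤ c d<a ⟩
      c + a       ≡⟨ +-comm c a ⟩
      a + c       ∎)

    cancel-suc-right : ∀ {a b c d} → a + b ≡ suc (c + d) → b ≡ suc d → a ≡ c
    cancel-suc-right {a} {b} {c} {d} eq b≡1+d =
      +-cancelʳ-≡ b a c (trans eq (trans (sym (+-suc c d)) (cong (c +_) (sym b≡1+d))))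

    cancel-left-suc : ∀ {a b c d} → a + b ≡ suc (c + d) → a ≡ c → b ≡ suc d
    cancel-left-suc {a} {b} {c} {d} eq a≡c =
      +-cancelˡ-≡ c b (suc d) (trans (cong (_+ b) (sym a≡c)) (trans eq (sym (+-suc c d))))

    cancel-right : ∀ {a b c d} → a + b ≡ suc (c + d) → b ≡ d → a ≡ suc c
    cancel-right {a} {b} {c} {d} eq b≡d = +-cancelʳ-≡ b a (suc c) (trans eq (cong (λ z → suc (c + z)) (sym b≡d)))

    cancel-left : ∀ {a b c d} → a + b ≡ suc (c + d) → a ≡ suc c → b ≡ d
    cancel-left {a} {b} {c} {d} eq a≡1+c = +-cancelˡ-≡ c b d (suc-injective (trans (cong (_+ b) (sym a≡1+c)) eq))

    -- Two instances of the dual rank formula (d, d' dual ranks, R the rank of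
    -- the ground set) combine into an exchange identity.
    exchange-arithmetic : ∀ {d d' R a x y} → d + R ≡ suc a + x → d' + R ≡ a + y → d + y ≡ suc (d' + x)
    exchange-arithmetic {d} {d'} {R} {a} {x} {y} eq eq' = +-cancelʳ-≡ R (d + y) (suc (d' + x)) (begin-equality
      d + y + R        ≡⟨ xy∙z≈xz∙y d y R ⟩
      d + R + y        ≡⟨ cong (_+ y) eq ⟩
      suc (a + x + y)  ≡⟨ cong suc (xy∙z≈xz∙y a x y) ⟩
      suc (a + y + x)  ≡⟨ cong (λ z → suc (z + x)) (sym eq') ⟩
      suc (d' + R + x) ≡⟨ cong suc (xy∙z≈xz∙y d' R x) ⟩
      suc (d' + x + R) ∎)

module MatroidRank {n : ℕ} (M : RankFn n) (isM : IsMatroid M) where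

  open import Data.Nat using (ℕ; zero; suc; _+_; _≤_; _<_; z≤n; s≤s)
  open import Data.Nat.Properties
  open import Data.Fin using (Fin)
  import Data.Fin.Properties as Fin
  open import Data.Fin.Patterns using (0F; 1F; 2F)
  open import Data.Vec using ([]; _∷_)
  open import Data.List using ([]; _∷_)
  open import Data.Fin.Subset
    using (Subset; _∈_; _∉_; _⊆_; _⊂_; _∪_; _∩_; _─_; _-_; ∣_∣; ⁅_⁆)
    renaming (⊥ to ∅)
  open import Data.Fin.Subset.Properties
    using (⊥⊆; ∣⊥∣≡0; ∣⁅x⁆∣≡1; ⊆-trans; ⊆-refl; p─q⊆p; nonempty?; Empty-unique;
           x∈p⇒p-x⊂p; x∈p⇒∣p-x∣<∣p∣; x∈p∧x≢y⇒x∈p-y; x∉⁅y⁆⇒x≢y; p─x─y≡p─y─x; _∈?_)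
  open import Data.Product using (∃; _×_; _,_)
  open import Data.Empty using (⊥-elim)
  open import Relation.Nullary using (yes; no)
  open import Relation.Nullary.Decidable using (_×-dec_)
  open import Relation.Binary.PropositionalEquality
  open IsMatroid isM
  open SubsetSolver
  open SubsetFacts
  open RankArithmetic

  E : Subset n
  E = ground M

  ρ : Subset n → ℕ
  ρ = rk M

  ρ-mono : ∀ {X Y} → Y ⊆ E → X ⊆ Y → ρ X ≤ ρ Y
  ρ-mono {X} {Y} = R2 X Y

  ρ-bound : ∀ {X} → X ⊆ E → ρ X ≤ ∣ X ∣
  ρ-bound {X} = R1 X

  ρ-submod : ∀ {X Y} → X ⊆ E → Y ⊆ E → ρ (X ∪ Y) + ρ (X ∩ Y) ≤ ρ X + ρ Y
  ρ-submod {X} {Y} = R3 X Y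

  ρ-∅ : ρ ∅ ≡ 0
  ρ-∅ = n≤0⇒n≡0 (subst (ρ ∅ ≤_) (∣⊥∣≡0 n) (ρ-bound ⊥⊆))

  ρ-subadditive : ∀ {X Y} → X ⊆ E → Y ⊆ E → ρ (X ∪ Y) ≤ ρ X + ρ Y
  ρ-subadditive {X} {Y} X⊆E Y⊆E = ≤-trans (m≤m+n (ρ (X ∪ Y)) (ρ (X ∩ Y))) (ρ-submod X⊆E Y⊆E)

  ρ-add : ∀ {X} {e : Fin n} → X ⊆ E → e ∈ E → ρ (X ∪ ⁅ e ⁆) ≤ suc (ρ X)
  ρ-add {X} {e} X⊆E e∈E = begin
    ρ (X ∪ ⁅ e ⁆) ≤⟨ ρ-subadditive X⊆E (∈⇒⁅⁆⊆ e∈E) ⟩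
    ρ X + ρ ⁅ e ⁆ ≤⟨ +-monoʳ-≤ (ρ X) (subst (ρ ⁅ e ⁆ ≤_) (∣⁅x⁆∣≡1 e) (ρ-bound (∈⇒⁅⁆⊆ e∈E))) ⟩
    ρ X + 1       ≡⟨ +-comm (ρ X) 1 ⟩
    suc (ρ X)     ∎
    where open ≤-Reasoning

  -- η(X) + r(X) = |X|: the truncated subtraction defining η never truncates.
  nullity-rank : ∀ {X} → X ⊆ E → η M X + ρ X ≡ ∣ X ∣
  nullity-rank X⊆E = m∸n+n≡m (ρ-bound X⊆E)

  Independent : Subset n → Set
  Independent X = ρ X ≡ ∣ X ∣

  independent-subset : ∀ {Y Z} → Y ⊆ E → Independent Y → Z ⊆ Y → Independent Z
  independent-subset {Y} {Z} Y⊆E indY Z⊆Y =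
    ≤-antisym (ρ-bound (⊆-trans Z⊆Y Y⊆E)) (≤-from-sum sizes (ρ-bound (⊆-trans (p─q⊆p Y Z) Y⊆E)))
    where
    open ≤-Reasoning
    env = Y ∷ Z ∷ []
    hyp = (var 1F ─' var 0F , ∅') ∷ []
    Z∪[Y─Z] : Z ∪ (Y ─ Z) ≡ Y
    Z∪[Y─Z] = prove hyp (var 1F ∪' (var 0F ─' var 1F)) (var 0F) env (⊆⇒─≡∅ Z⊆Y , _)
    Z∩[Y─Z] : Z ∩ (Y ─ Z) ≡ ∅
    Z∩[Y─Z] = prove [] (var 1F ∩' (var 0F ─' var 1F)) ∅' env _
    Y∩Z : Y ∩ Z ≡ Z
    Y∩Z = prove hyp (var 0F ∩' var 1F) (var 1F) env (⊆⇒─≡∅ Z⊆Y , _)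
    sizes : ∣ Y ─ Z ∣ + ∣ Z ∣ ≤ ρ Z + ρ (Y ─ Z)
    sizes = begin
      ∣ Y ─ Z ∣ + ∣ Z ∣                 ≡⟨ +-comm ∣ Y ─ Z ∣ ∣ Z ∣ ⟩
      ∣ Z ∣ + ∣ Y ─ Z ∣                 ≡⟨ cong (λ s → ∣ s ∣ + ∣ Y ─ Z ∣) (sym Y∩Z) ⟩
      ∣ Y ∩ Z ∣ + ∣ Y ─ Z ∣             ≡⟨ sym (card-split Y Z) ⟩
      ∣ Y ∣                             ≡⟨ sym indY ⟩
      ρ Y                               ≡⟨ sym (+-identityʳ _) ⟩
      ρ Y + 0                           ≡⟨ cong₂ (λ a b → ρ a + b) (sym Z∪[Y─Z]) (sym (trans (cong ρ Z∩[Y─Z]) ρ-∅)) ⟩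
      ρ (Z ∪ (Y ─ Z)) + ρ (Z ∩ (Y ─ Z)) ≤⟨ ρ-submod (⊆-trans Z⊆Y Y⊆E) (⊆-trans (p─q⊆p Y Z) Y⊆E) ⟩
      ρ Z + ρ (Y ─ Z)                   ∎

  essential-in-subset : ∀ {A Y} {f : Fin n} → Y ⊆ E → A ⊆ Y → f ∈ A → ρ (Y - f) < ρ Y → ρ (A - f) < ρ A
  essential-in-subset {A} {Y} {f} Y⊆E A⊆Y f∈A drop = <-from-sum submod drop
    where
    env = Y ∷ A ∷ ⁅ f ⁆ ∷ []
    hyps = (var 1F ─' var 0F , ∅') ∷ (var 2F ─' var 1F , ∅') ∷ []
    hyps✓ = ⊆⇒─≡∅ A⊆Y , ⊆⇒─≡∅ (∈⇒⁅⁆⊆ f∈A) , _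
    A∪[Y-f] : A ∪ (Y - f) ≡ Y
    A∪[Y-f] = prove hyps (var 1F ∪' (var 0F ─' var 2F)) (var 0F) env hyps✓
    A∩[Y-f] : A ∩ (Y - f) ≡ A - f
    A∩[Y-f] = prove hyps (var 1F ∩' (var 0F ─' var 2F)) (var 1F ─' var 2F) env hyps✓
    submod : ρ Y + ρ (A - f) ≤ ρ A + ρ (Y - f)
    submod = subst₂ (λ a b → ρ a + ρ b ≤ ρ A + ρ (Y - f)) A∪[Y-f] A∩[Y-f]
               (ρ-submod (⊆-trans A⊆Y Y⊆E) (⊆-trans (p─q⊆p Y ⁅ f ⁆) Y⊆E))

  independent-if-all-essential : ∀ {Y} → Y ⊆ E → (∀ f → f ∈ Y → ρ (Y - f) < ρ Y) → Independent Y
  independent-if-all-essential {Y} Y⊆E essential = ≤-antisym (ρ-bound Y⊆E) (size≤rank ∣ Y ∣ Y ≤-refl ⊆-refl)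
    where
    open ≤-Reasoning
    size≤rank : ∀ m A → ∣ A ∣ ≤ m → A ⊆ Y → ∣ A ∣ ≤ ρ A
    size≤rank m A |A|≤m A⊆Y with nonempty? A
    ... | no ¬ne = subst (_≤ ρ A) (sym (trans (cong ∣_∣ (Empty-unique ¬ne)) (∣⊥∣≡0 n))) z≤n
    ... | yes (f , f∈A) with m | subst (_≤ m) (card-remove f∈A) |A|≤m
    ...   | suc m' | s≤s |A-f|≤m' = begin
      ∣ A ∣          ≡⟨ card-remove f∈A ⟩
      suc ∣ A - f ∣  ≤⟨ s≤s (size≤rank m' (A - f) |A-f|≤m' (⊆-trans (p─q⊆p A ⁅ f ⁆) A⊆Y)) ⟩
      suc (ρ (A - f)) ≤⟨ essential-in-subset Y⊆E A⊆Y f∈A (essential f (A⊆Y f∈A)) ⟩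
      ρ A            ∎

  Cyclic : Subset n → Set
  Cyclic X = ∀ e → e ∈ X → ρ (X - e) ≡ ρ X

  Closed : Subset n → Set
  Closed X = ∀ e → e ∈ E → e ∉ X → ρ X < ρ (X ∪ ⁅ e ⁆)

  redundant-in-superset : ∀ {C X} {e : Fin n} → X ⊆ E → C ⊆ X → e ∈ C → ρ C ≤ ρ (C - e) → ρ (X - e) ≡ ρ X
  redundant-in-superset {C} {X} {e} X⊆E C⊆X e∈C ρC≤ρ[C-e] =
    ≤-antisym (ρ-mono X⊆E (p─q⊆p X ⁅ e ⁆)) (≤-from-sum submod ρC≤ρ[C-e])
    where
    env = X ∷ C ∷ ⁅ e ⁆ ∷ []
    hyps = (var 1F ─' var 0F , ∅') ∷ (var 2F ─' var 1F , ∅') ∷ []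
    hyps✓ = ⊆⇒─≡∅ C⊆X , ⊆⇒─≡∅ (∈⇒⁅⁆⊆ e∈C) , _
    [X-e]∪C : (X - e) ∪ C ≡ X
    [X-e]∪C = prove hyps ((var 0F ─' var 2F) ∪' var 1F) (var 0F) env hyps✓
    [X-e]∩C : (X - e) ∩ C ≡ C - e
    [X-e]∩C = prove hyps ((var 0F ─' var 2F) ∩' var 1F) (var 1F ─' var 2F) env hyps✓
    submod : ρ (C - e) + ρ X ≤ ρ (X - e) + ρ C
    submod = subst₂ (λ a b → ρ b + ρ a ≤ ρ (X - e) + ρ C) [X-e]∪C [X-e]∩C
               (subst (_≤ ρ (X - e) + ρ C) (+-comm (ρ ((X - e) ∪ C)) _)
                 (ρ-submod (⊆-trans (p─q⊆p X ⁅ e ⁆) X⊆E) (⊆-trans C⊆X X⊆E)))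

  unionOfCircuits⇒cyclic : ∀ {X} → X ⊆ E → UnionOfCircuits M X → Cyclic X
  unionOfCircuits⇒cyclic X⊆E circuits e e∈X with circuits e e∈X
  ... | C , (_ , dependent , minimal) , C⊆X , e∈C =
    redundant-in-superset X⊆E C⊆X e∈C (≤-pred (begin
      suc (ρ C)         ≤⟨ dependent ⟩
      ∣ C ∣             ≡⟨ card-remove e∈C ⟩
      suc ∣ C - e ∣     ≡⟨ cong suc (sym (minimal (C - e) (x∈p⇒p-x⊂p e∈C))) ⟩
      suc (ρ (C - e))   ∎))
    where open ≤-Reasoning

  circuit-criterion : ∀ {D} {e : Fin n} → D ⊆ E → e ∈ D → ρ (D - e) ≡ ρ D →
                      (∀ f → f ∈ D - e → ρ (D - f - e) < ρ (D - f)) → Circuit M D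
  circuit-criterion {D} {e} D⊆E e∈D e-redundant stuck = D⊆E , dependent , minimal
    where
    open ≤-Reasoning
    D-e⊆E : D - e ⊆ E
    D-e⊆E = ⊆-trans (p─q⊆p D ⁅ e ⁆) D⊆E

    independent-D-e : Independent (D - e)
    independent-D-e = independent-if-all-essential D-e⊆E λ f f∈D-e → begin-strict
      ρ (D - e - f) ≡⟨ cong ρ (p─x─y≡p─y─x D e f) ⟩
      ρ (D - f - e) <⟨ stuck f f∈D-e ⟩
      ρ (D - f)     ≤⟨ ρ-mono D⊆E (p─q⊆p D ⁅ f ⁆) ⟩
      ρ D           ≡⟨ sym e-redundant ⟩
      ρ (D - e)     ∎

    dependent : ρ D < ∣ D ∣
    dependent = begin-strict
      ρ D           ≡⟨ sym e-redundant ⟩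
      ρ (D - e)     ≡⟨ independent-D-e ⟩
      ∣ D - e ∣     <⟨ n<1+n _ ⟩
      suc ∣ D - e ∣ ≡⟨ sym (card-remove e∈D) ⟩
      ∣ D ∣         ∎

    independent-deletion : ∀ x → x ∈ D → Independent (D - x)
    independent-deletion x x∈D with x Fin.≟ e
    ... | yes refl = independent-D-e
    ... | no x≢e = ≤-antisym (ρ-bound (⊆-trans (p─q⊆p D ⁅ x ⁆) D⊆E)) (begin
      ∣ D - x ∣           ≡⟨ card-remove (x∈p∧x≢y⇒x∈p-y e∈D (λ e≡x → x≢e (sym e≡x))) ⟩
      suc ∣ D - x - e ∣   ≡⟨ cong suc (sym independent-D-x-e) ⟩
      suc (ρ (D - x - e)) ≤⟨ stuck x (x∈p∧x≢y⇒x∈p-y x∈D x≢e) ⟩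
      ρ (D - x)           ∎)
      where
      independent-D-x-e : Independent (D - x - e)
      independent-D-x-e = independent-subset D-e⊆E independent-D-e
        (λ y∈ → p─q⊆p (D - e) ⁅ x ⁆ (subst (_ ∈_) (p─x─y≡p─y─x D x e) y∈))

    minimal : ∀ Y → Y ⊂ D → ρ Y ≡ ∣ Y ∣
    minimal Y (Y⊆D , x , x∈D , x∉Y) =
      independent-subset (⊆-trans (p─q⊆p D ⁅ x ⁆) D⊆E) (independent-deletion x x∈D)
        (λ y∈Y → x∈p∧x≢y⇒x∈p-y (Y⊆D y∈Y) (λ y≡x → x∉Y (subst (_∈ Y) y≡x y∈Y)))

  CircuitThrough : Fin n → Subset n → Set
  CircuitThrough e D = ∃ λ C → Circuit M C × C ⊆ D × e ∈ C

  -- A redundant element lies on a circuit: delete other elements while e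
  -- stays redundant; when none can be deleted, circuit-criterion applies.
  -- The first argument bounds |D| and decreases with each deletion.
  circuit-through : ∀ m {D} {e : Fin n} → ∣ D ∣ ≤ m → D ⊆ E → e ∈ D → ρ (D - e) ≡ ρ D → CircuitThrough e D
  circuit-through zero    {D} {e} |D|≤0 _ e∈D _ = ⊥-elim (n≮0 (subst (_≤ 0) (card-remove e∈D) |D|≤0))
  circuit-through (suc m) {D} {e} |D|≤m D⊆E e∈D e-redundant
    with Fin.any? (λ f → (f ∈? D - e) ×-dec (ρ (D - f - e) ≟ ρ (D - f)))
  ... | yes (f , f∈D-e , still-redundant)
    with circuit-through m (≤-pred (≤-trans (x∈p⇒∣p-x∣<∣p∣ f∈D) |D|≤m))
           (⊆-trans (p─q⊆p D ⁅ f ⁆) D⊆E) (x∈p∧x≢y⇒x∈p-y e∈D (λ e≡f → f≢e (sym e≡f))) still-redundant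
    where
    f∈D : f ∈ D
    f∈D = p─q⊆p D ⁅ e ⁆ f∈D-e
    f≢e : f ≢ e
    f≢e = x∉⁅y⁆⇒x≢y (∈─⇒∉ D ⁅ e ⁆ f∈D-e)
  ...   | C , circuit , C⊆D-f , e∈C = C , circuit , ⊆-trans C⊆D-f (p─q⊆p D ⁅ f ⁆) , e∈C
  circuit-through (suc m) {D} {e} |D|≤m D⊆E e∈D e-redundant
      | no none = D , circuit-criterion D⊆E e∈D e-redundant stuck , ⊆-refl , e∈D
    where
    stuck : ∀ f → f ∈ D - e → ρ (D - f - e) < ρ (D - f)
    stuck f f∈D-e = ≤∧≢⇒< (ρ-mono (⊆-trans (p─q⊆p D ⁅ f ⁆) D⊆E) (p─q⊆p (D - f) ⁅ e ⁆))
                          (λ still-redundant → none (f , f∈D-e , still-redundant))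

  cyclic⇒unionOfCircuits : ∀ {X} → X ⊆ E → Cyclic X → UnionOfCircuits M X
  cyclic⇒unionOfCircuits {X} X⊆E cyclic e e∈X = circuit-through ∣ X ∣ ≤-refl X⊆E e∈X (cyclic e e∈X)

  cyclicFlat⇒⊆ : ∀ {X} → CyclicFlat M X → X ⊆ E
  cyclicFlat⇒⊆ ((X⊆E , _) , _) = X⊆E

  cyclicFlat⇒closed : ∀ {X} → CyclicFlat M X → Closed X
  cyclicFlat⇒closed ((_ , closed) , _) = closed

  cyclicFlat⇒cyclic : ∀ {X} → CyclicFlat M X → Cyclic X
  cyclicFlat⇒cyclic ((X⊆E , _) , circuits) = unionOfCircuits⇒cyclic X⊆E circuits

  cyclicFlat-intro : ∀ {X} → X ⊆ E → Closed X → Cyclic X → CyclicFlat M X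
  cyclicFlat-intro X⊆E closed cyclic = (X⊆E , closed) , cyclic⇒unionOfCircuits X⊆E cyclic

module Duality {n : ℕ} (M : RankFn n) (isM : IsMatroid M) where

  open import Data.Nat using (ℕ; suc; _+_; _≤_)
  open import Data.Nat.Properties
  open import Algebra.Properties.CommutativeSemigroup +-commutativeSemigroup using (interchange)
  open import Data.Fin.Patterns using (0F; 1F; 2F)
  open import Data.Vec using ([]; _∷_)
  open import Data.List using ([]; _∷_)
  open import Data.Fin.Subset
    using (Subset; _∈_; _∉_; _⊆_; _∪_; _∩_; _─_; _-_; ∣_∣; ⁅_⁆)
    renaming (⊥ to ∅)
  open import Data.Fin.Subset.Properties using (⊆-trans; ⊆-refl; p─q⊆p; x∈p∧x∉q⇒x∈p─q)
  open import Data.Product using (_,_)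
  open import Relation.Binary.PropositionalEquality
  open SubsetSolver
  open SubsetFacts
  open RankArithmetic
  open MatroidRank M isM

  ρ* : Subset n → ℕ
  ρ* = rk (dual M)

  complement-rank-bound : ∀ {X} → X ⊆ E → ρ E ≤ ∣ X ∣ + ρ (E ─ X)
  complement-rank-bound {X} X⊆E = begin
    ρ E               ≡⟨ cong ρ (sym X∪[E─X]) ⟩
    ρ (X ∪ (E ─ X))   ≤⟨ ρ-subadditive X⊆E (p─q⊆p E X) ⟩
    ρ X + ρ (E ─ X)   ≤⟨ +-monoˡ-≤ (ρ (E ─ X)) (ρ-bound X⊆E) ⟩
    ∣ X ∣ + ρ (E ─ X) ∎
    where
    open ≤-Reasoning
    X∪[E─X] : X ∪ (E ─ X) ≡ E
    X∪[E─X] = prove ((var 1F ─' var 0F , ∅') ∷ []) (var 1F ∪' (var 0F ─' var 1F)) (var 0F)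
                (E ∷ X ∷ []) (⊆⇒─≡∅ X⊆E , _)

  -- The dual rank formula without truncated subtraction.
  dual-rank : ∀ {X} → X ⊆ E → ρ* X + ρ E ≡ ∣ X ∣ + ρ (E ─ X)
  dual-rank X⊆E = m∸n+n≡m (complement-rank-bound X⊆E)

  dual-isMatroid : IsMatroid (dual M)
  dual-isMatroid = record { R1 = bound ; R2 = mono ; R3 = submod }
    where
    open ≤-Reasoning
    bound : ∀ X → X ⊆ E → ρ* X ≤ ∣ X ∣
    bound X X⊆E = +-cancelʳ-≤ (ρ E) (ρ* X) ∣ X ∣ (begin
      ρ* X + ρ E        ≡⟨ dual-rank X⊆E ⟩
      ∣ X ∣ + ρ (E ─ X) ≤⟨ +-monoʳ-≤ ∣ X ∣ (ρ-mono ⊆-refl (p─q⊆p E X)) ⟩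
      ∣ X ∣ + ρ E       ∎)

    mono : ∀ X Y → Y ⊆ E → X ⊆ Y → ρ* X ≤ ρ* Y
    mono X Y Y⊆E X⊆Y = +-cancelʳ-≤ (ρ E) (ρ* X) (ρ* Y) (begin
      ρ* X + ρ E                          ≡⟨ dual-rank (⊆-trans X⊆Y Y⊆E) ⟩
      ∣ X ∣ + ρ (E ─ X)                   ≡⟨ cong (λ s → ∣ X ∣ + ρ s) [Y─X]∪[E─Y] ⟨
      ∣ X ∣ + ρ ((Y ─ X) ∪ (E ─ Y))       ≤⟨ +-monoʳ-≤ ∣ X ∣ (ρ-subadditive Y─X⊆E (p─q⊆p E Y)) ⟩
      ∣ X ∣ + (ρ (Y ─ X) + ρ (E ─ Y))     ≤⟨ +-monoʳ-≤ ∣ X ∣ (+-monoˡ-≤ (ρ (E ─ Y)) (ρ-bound Y─X⊆E)) ⟩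
      ∣ X ∣ + (∣ Y ─ X ∣ + ρ (E ─ Y))     ≡⟨ +-assoc ∣ X ∣ _ _ ⟨
      (∣ X ∣ + ∣ Y ─ X ∣) + ρ (E ─ Y)     ≡⟨ cong (λ s → (∣ s ∣ + ∣ Y ─ X ∣) + ρ (E ─ Y)) Y∩X ⟨
      (∣ Y ∩ X ∣ + ∣ Y ─ X ∣) + ρ (E ─ Y) ≡⟨ cong (_+ ρ (E ─ Y)) (card-split Y X) ⟨
      ∣ Y ∣ + ρ (E ─ Y)                   ≡⟨ dual-rank Y⊆E ⟨
      ρ* Y + ρ E                          ∎)
      where
      Y─X⊆E = ⊆-trans (p─q⊆p Y X) Y⊆E
      env = E ∷ Y ∷ X ∷ []
      hyps = (var 2F ─' var 1F , ∅') ∷ (var 1F ─' var 0F , ∅') ∷ []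
      hyps✓ = ⊆⇒─≡∅ X⊆Y , ⊆⇒─≡∅ Y⊆E , _
      [Y─X]∪[E─Y] : (Y ─ X) ∪ (E ─ Y) ≡ E ─ X
      [Y─X]∪[E─Y] = prove hyps ((var 1F ─' var 2F) ∪' (var 0F ─' var 1F)) (var 0F ─' var 2F) env hyps✓
      Y∩X : Y ∩ X ≡ X
      Y∩X = prove hyps (var 1F ∩' var 2F) (var 2F) env hyps✓

    submod : ∀ X Y → X ⊆ E → Y ⊆ E → ρ* (X ∪ Y) + ρ* (X ∩ Y) ≤ ρ* X + ρ* Y
    submod X Y X⊆E Y⊆E = +-cancelʳ-≤ (ρ E + ρ E) _ _ (begin
      (ρ* (X ∪ Y) + ρ* (X ∩ Y)) + (ρ E + ρ E)
        ≡⟨ interchange (ρ* (X ∪ Y)) _ _ _ ⟩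
      (ρ* (X ∪ Y) + ρ E) + (ρ* (X ∩ Y) + ρ E)
        ≡⟨ cong₂ _+_ (dual-rank (∪-⊆ X⊆E Y⊆E)) (dual-rank (⊆-trans (p∩q⊆p X Y) X⊆E)) ⟩
      (∣ X ∪ Y ∣ + ρ (E ─ (X ∪ Y))) + (∣ X ∩ Y ∣ + ρ (E ─ (X ∩ Y)))
        ≡⟨ interchange ∣ X ∪ Y ∣ _ _ _ ⟩
      (∣ X ∪ Y ∣ + ∣ X ∩ Y ∣) + (ρ (E ─ (X ∪ Y)) + ρ (E ─ (X ∩ Y)))
        ≤⟨ +-mono-≤ (≤-reflexive (card-∪∩ X Y)) complements ⟩
      (∣ X ∣ + ∣ Y ∣) + (ρ (E ─ X) + ρ (E ─ Y))
        ≡⟨ interchange ∣ X ∣ _ _ _ ⟩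
      (∣ X ∣ + ρ (E ─ X)) + (∣ Y ∣ + ρ (E ─ Y))
        ≡⟨ cong₂ _+_ (dual-rank X⊆E) (dual-rank Y⊆E) ⟨
      (ρ* X + ρ E) + (ρ* Y + ρ E)
        ≡⟨ interchange (ρ* X) _ _ _ ⟩
      (ρ* X + ρ* Y) + (ρ E + ρ E) ∎)
      where
      open Data.Fin.Subset.Properties using (p∩q⊆p)
      env = E ∷ X ∷ Y ∷ []
      [E─X]∪[E─Y] : (E ─ X) ∪ (E ─ Y) ≡ E ─ (X ∩ Y)
      [E─X]∪[E─Y] = prove [] ((var 0F ─' var 1F) ∪' (var 0F ─' var 2F)) (var 0F ─' (var 1F ∩' var 2F)) env _
      [E─X]∩[E─Y] : (E ─ X) ∩ (E ─ Y) ≡ E ─ (X ∪ Y)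
      [E─X]∩[E─Y] = prove [] ((var 0F ─' var 1F) ∩' (var 0F ─' var 2F)) (var 0F ─' (var 1F ∪' var 2F)) env _
      complements : ρ (E ─ (X ∪ Y)) + ρ (E ─ (X ∩ Y)) ≤ ρ (E ─ X) + ρ (E ─ Y)
      complements = subst (_≤ ρ (E ─ X) + ρ (E ─ Y))
        (trans (cong₂ (λ a b → ρ a + ρ b) [E─X]∪[E─Y] [E─X]∩[E─Y]) (+-comm (ρ (E ─ (X ∩ Y))) _))
        (ρ-submod (p─q⊆p E X) (p─q⊆p E Y))

  module D = MatroidRank (dual M) dual-isMatroid

  -- For e ∈ E − X, adding e to X in M mirrors deleting e from E − X in M*.
  exchange-out : ∀ {X e} → X ⊆ E → e ∈ E → e ∉ X → ρ* (E ─ X) + ρ (X ∪ ⁅ e ⁆) ≡ suc (ρ* (E ─ X - e) + ρ X)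
  exchange-out {X} {e} X⊆E e∈E e∉X =
    exchange-arithmetic {ρ* (E ─ X)} {ρ* (E ─ X - e)} {ρ E} {∣ E ─ X - e ∣} {ρ X} {ρ (X ∪ ⁅ e ⁆)} before after
    where
    e∈E─X : e ∈ E ─ X
    e∈E─X = x∈p∧x∉q⇒x∈p─q e∈E e∉X
    E─[E─X-e] : E ─ (E ─ X - e) ≡ X ∪ ⁅ e ⁆
    E─[E─X-e] = prove ((var 1F ─' var 0F , ∅') ∷ (var 2F ─' var 0F , ∅') ∷ [])
      (var 0F ─' (var 0F ─' var 1F ─' var 2F)) (var 1F ∪' var 2F)
      (E ∷ X ∷ ⁅ e ⁆ ∷ []) (⊆⇒─≡∅ X⊆E , ⊆⇒─≡∅ (∈⇒⁅⁆⊆ e∈E) , _)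
    before : ρ* (E ─ X) + ρ E ≡ suc ∣ E ─ X - e ∣ + ρ X
    before = trans (dual-rank (p─q⊆p E X)) (cong₂ (λ a b → a + ρ b) (card-remove e∈E─X) (complement-involutive X⊆E))
    after : ρ* (E ─ X - e) + ρ E ≡ ∣ E ─ X - e ∣ + ρ (X ∪ ⁅ e ⁆)
    after = trans (dual-rank (⊆-trans (p─q⊆p (E ─ X) ⁅ e ⁆) (p─q⊆p E X))) (cong (λ s → ∣ E ─ X - e ∣ + ρ s) E─[E─X-e])

  -- For e ∈ X, deleting e from X in M mirrors adding e to E − X in M*.
  exchange-in : ∀ {X e} → X ⊆ E → e ∈ X → ρ* ((E ─ X) ∪ ⁅ e ⁆) + ρ X ≡ suc (ρ* (E ─ X) + ρ (X - e))
  exchange-in {X} {e} X⊆E e∈X =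
    exchange-arithmetic {ρ* ((E ─ X) ∪ ⁅ e ⁆)} {ρ* (E ─ X)} {ρ E} {∣ E ─ X ∣} {ρ (X - e)} {ρ X} after before
    where
    E─[[E─X]∪e] : E ─ ((E ─ X) ∪ ⁅ e ⁆) ≡ X - e
    E─[[E─X]∪e] = prove ((var 1F ─' var 0F , ∅') ∷ []) (var 0F ─' ((var 0F ─' var 1F) ∪' var 2F)) (var 1F ─' var 2F)
      (E ∷ X ∷ ⁅ e ⁆ ∷ []) (⊆⇒─≡∅ X⊆E , _)
    after : ρ* ((E ─ X) ∪ ⁅ e ⁆) + ρ E ≡ suc ∣ E ─ X ∣ + ρ (X - e)
    after = trans (dual-rank (∪-⊆ (p─q⊆p E X) (∈⇒⁅⁆⊆ (X⊆E e∈X))))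
                  (cong₂ (λ a b → a + ρ b) (card-add (λ e∈E─X → ∈─⇒∉ E X e∈E─X e∈X)) E─[[E─X]∪e])
    before : ρ* (E ─ X) + ρ E ≡ ∣ E ─ X ∣ + ρ X
    before = trans (dual-rank (p─q⊆p E X)) (cong (λ s → ∣ E ─ X ∣ + ρ s) (complement-involutive X⊆E))

  module _ {X} (X⊆E : X ⊆ E) where

    closed⇒dual-cyclic : Closed X → D.Cyclic (E ─ X)
    closed⇒dual-cyclic closed e e∈E─X = sym (cancel-suc-right (exchange-out X⊆E e∈E e∉X) jump)
      where
      e∈E = p─q⊆p E X e∈E─X
      e∉X = ∈─⇒∉ E X e∈E─X
      jump : ρ (X ∪ ⁅ e ⁆) ≡ suc (ρ X)
      jump = ≤-antisym (ρ-add X⊆E e∈E) (closed e e∈E e∉X)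

    dual-cyclic⇒closed : D.Cyclic (E ─ X) → Closed X
    dual-cyclic⇒closed cyclic e e∈E e∉X =
      ≤-reflexive (sym (cancel-left-suc (exchange-out X⊆E e∈E e∉X) (sym (cyclic e (x∈p∧x∉q⇒x∈p─q e∈E e∉X)))))

    cyclic⇒dual-closed : Cyclic X → D.Closed (E ─ X)
    cyclic⇒dual-closed cyclic e e∈E e∉E─X =
      ≤-reflexive (sym (cancel-right (exchange-in X⊆E e∈X) (sym (cyclic e e∈X))))
      where e∈X = ∉-complement e∈E e∉E─X

    dual-closed⇒cyclic : D.Closed (E ─ X) → Cyclic X
    dual-closed⇒cyclic closed e e∈X = sym (cancel-left (exchange-in X⊆E e∈X) jump)
      where
      e∈E = X⊆E e∈X
      jump : ρ* ((E ─ X) ∪ ⁅ e ⁆) ≡ suc (ρ* (E ─ X))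
      jump = ≤-antisym (D.ρ-add (p─q⊆p E X) e∈E) (closed e e∈E (λ e∈E─X → ∈─⇒∉ E X e∈E─X e∈X))

  cyclicFlat-dual : ∀ {X} → CyclicFlat M X → CyclicFlat (dual M) (E ─ X)
  cyclicFlat-dual cf = D.cyclicFlat-intro (p─q⊆p E _)
    (cyclic⇒dual-closed X⊆E (cyclicFlat⇒cyclic cf)) (closed⇒dual-cyclic X⊆E (cyclicFlat⇒closed cf))
    where X⊆E = cyclicFlat⇒⊆ cf

  cyclicFlat-undual : ∀ {Y} → CyclicFlat (dual M) Y → CyclicFlat M (E ─ Y)
  cyclicFlat-undual {Y} cf = cyclicFlat-intro E─Y⊆E
    (dual-cyclic⇒closed E─Y⊆E (subst D.Cyclic (sym E─[E─Y]) (D.cyclicFlat⇒cyclic cf)))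
    (dual-closed⇒cyclic E─Y⊆E (subst D.Closed (sym E─[E─Y]) (D.cyclicFlat⇒closed cf)))
    where
    E─Y⊆E = p─q⊆p E Y
    E─[E─Y] : E ─ (E ─ Y) ≡ Y
    E─[E─Y] = complement-involutive (D.cyclicFlat⇒⊆ cf)

  nonemptyProper-dual : ∀ {F} → NPCyclicFlat M F → NPCyclicFlat (dual M) (E ─ F)
  nonemptyProper-dual (cf , nonempty , proper) =
    cyclicFlat-dual cf , complement-nonempty-proper (cyclicFlat⇒⊆ cf) nonempty proper

  nonemptyProper-undual : ∀ {G} → NPCyclicFlat (dual M) G → NPCyclicFlat M (E ─ G)
  nonemptyProper-undual (cf , nonempty , proper) =
    cyclicFlat-undual cf , complement-nonempty-proper (D.cyclicFlat⇒⊆ cf) nonempty proper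

  dual-rank-total : r (dual M) + r M ≡ ∣ E ∣
  dual-rank-total = begin
    ρ* E + ρ E        ≡⟨ dual-rank ⊆-refl ⟩
    ∣ E ∣ + ρ (E ─ E) ≡⟨ cong (λ s → ∣ E ∣ + ρ s) (prove [] (var 0F ─' var 0F) ∅' (E ∷ []) _) ⟩
    ∣ E ∣ + ρ ∅       ≡⟨ cong (∣ E ∣ +_) ρ-∅ ⟩
    ∣ E ∣ + 0         ≡⟨ +-identityʳ ∣ E ∣ ⟩
    ∣ E ∣             ∎
    where open ≡-Reasoning

  dual-nullity : ∀ {A} → A ⊆ E → η (dual M) (E ─ A) + ρ A ≡ r M
  dual-nullity {A} A⊆E = +-cancelˡ-≡ (ρ* (E ─ A)) _ _ (begin
    ρ* (E ─ A) + (η (dual M) (E ─ A) + ρ A) ≡⟨ +-assoc (ρ* (E ─ A)) _ _ ⟨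
    (ρ* (E ─ A) + η (dual M) (E ─ A)) + ρ A ≡⟨ cong (_+ ρ A) (+-comm (ρ* (E ─ A)) _) ⟩
    (η (dual M) (E ─ A) + ρ* (E ─ A)) + ρ A ≡⟨ cong (_+ ρ A) (D.nullity-rank (p─q⊆p E A)) ⟩
    ∣ E ─ A ∣ + ρ A                         ≡⟨ cong (λ s → ∣ E ─ A ∣ + ρ s) (complement-involutive A⊆E) ⟨
    ∣ E ─ A ∣ + ρ (E ─ (E ─ A))             ≡⟨ dual-rank (p─q⊆p E A) ⟨
    ρ* (E ─ A) + ρ E                        ∎)
    where open ≡-Reasoning

module ConstructionDuality where

  open import Data.Nat using (_+_)
  open import Data.Nat.Properties using (+-assoc; +-cancelʳ-≡)
  open import Data.Nat.Tactic.RingSolver using (solve-∀)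
  open import Data.Fin.Patterns using (0F; 1F; 2F; 3F; 4F; 5F; 6F)
  open import Data.Vec using (Vec; []; _∷_)
  open import Data.List using ([]; _∷_)
  open import Data.Fin.Subset using (Subset; _⊆_; _∪_; _∩_; _─_; ∣_∣) renaming (⊥ to ∅)
  open import Data.Fin.Subset.Properties using (p─q⊆p)
  open import Data.Product using (∃; _×_; _,_; proj₁)
  open import Relation.Binary.PropositionalEquality
  open ≡-Reasoning
  open SubsetSolver
  open SubsetFacts

  record Layout {n} (E S₁ S₂ T₁ T₂ : Subset n) : Set where
    field
      cover : E ≡ S₁ ∪ S₂ ∪ T₁ ∪ T₂
      S₁∩S₂ : S₁ ∩ S₂ ≡ ∅
      T₁∩T₂ : T₁ ∩ T₂ ≡ ∅
      T₁∩S  : T₁ ∩ (S₁ ∪ S₂) ≡ ∅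
      T₂∩S  : T₂ ∩ (S₁ ∪ S₂) ≡ ∅

  -- A layout as solver hypotheses on the first five variables E, S₁, S₂, T₁, T₂.
  layout-equations : ∀ {k} → Equations (5 + k)
  layout-equations = (var 0F , var 1F ∪' var 2F ∪' var 3F ∪' var 4F)
                   ∷ (var 1F ∩' var 2F , ∅')
                   ∷ (var 3F ∩' var 4F , ∅')
                   ∷ (var 3F ∩' (var 1F ∪' var 2F) , ∅')
                   ∷ (var 4F ∩' (var 1F ∪' var 2F) , ∅')
                   ∷ []

  layout-holds : ∀ {n k} {E S₁ S₂ T₁ T₂ : Subset n} → Layout E S₁ S₂ T₁ T₂ →
                 (env : Vec (Subset n) k) → Holds layout-equations (E ∷ S₁ ∷ S₂ ∷ T₁ ∷ T₂ ∷ env)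
  layout-holds L _ = cover , S₁∩S₂ , T₁∩T₂ , T₁∩S , T₂∩S , _
    where open Layout L

  swap : ∀ {n} {E S₁ S₂ T₁ T₂ : Subset n} → Layout E S₁ S₂ T₁ T₂ → Layout E S₂ S₁ T₂ T₁
  swap {E = E} {S₁} {S₂} {T₁} {T₂} L = record
    { cover = prove layout-equations (var 0F) (var 2F ∪' var 1F ∪' var 4F ∪' var 3F) env L✓
    ; S₁∩S₂ = prove layout-equations (var 2F ∩' var 1F) ∅' env L✓
    ; T₁∩T₂ = prove layout-equations (var 4F ∩' var 3F) ∅' env L✓
    ; T₁∩S  = prove layout-equations (var 4F ∩' (var 2F ∪' var 1F)) ∅' env L✓
    ; T₂∩S  = prove layout-equations (var 3F ∩' (var 2F ∪' var 1F)) ∅' env L✓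
    }
    where
    env = E ∷ S₁ ∷ S₂ ∷ T₁ ∷ T₂ ∷ []
    L✓ = layout-holds L []

  layout-card : ∀ {n} {E S₁ S₂ T₁ T₂ : Subset n} → Layout E S₁ S₂ T₁ T₂ →
                ∣ E ∣ ≡ ∣ S₁ ∣ + ∣ S₂ ∣ + ∣ T₁ ∣ + ∣ T₂ ∣
  layout-card {E = E} {S₁} {S₂} {T₁} {T₂} L = begin
    ∣ E ∣                                 ≡⟨ cong ∣_∣ (Layout.cover L) ⟩
    ∣ S₁ ∪ S₂ ∪ T₁ ∪ T₂ ∣                 ≡⟨ card-∪-disjoint S₁ _ S₁∩[S₂∪T] ⟩
    ∣ S₁ ∣ + ∣ S₂ ∪ T₁ ∪ T₂ ∣             ≡⟨ cong (∣ S₁ ∣ +_) (card-∪-disjoint S₂ _ S₂∩T) ⟩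
    ∣ S₁ ∣ + (∣ S₂ ∣ + ∣ T₁ ∪ T₂ ∣)       ≡⟨ cong (λ t → ∣ S₁ ∣ + (∣ S₂ ∣ + t)) (card-∪-disjoint T₁ T₂ (Layout.T₁∩T₂ L)) ⟩
    ∣ S₁ ∣ + (∣ S₂ ∣ + (∣ T₁ ∣ + ∣ T₂ ∣)) ≡⟨ +-assoc ∣ S₁ ∣ ∣ S₂ ∣ _ ⟨
    ∣ S₁ ∣ + ∣ S₂ ∣ + (∣ T₁ ∣ + ∣ T₂ ∣)   ≡⟨ +-assoc (∣ S₁ ∣ + ∣ S₂ ∣) ∣ T₁ ∣ ∣ T₂ ∣ ⟨
    ∣ S₁ ∣ + ∣ S₂ ∣ + ∣ T₁ ∣ + ∣ T₂ ∣     ∎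
    where
    env = E ∷ S₁ ∷ S₂ ∷ T₁ ∷ T₂ ∷ []
    S₁∩[S₂∪T] : S₁ ∩ (S₂ ∪ T₁ ∪ T₂) ≡ ∅
    S₁∩[S₂∪T] = prove layout-equations (var 1F ∩' (var 2F ∪' var 3F ∪' var 4F)) ∅' env (layout-holds L [])
    S₂∩T : S₂ ∩ (T₁ ∪ T₂) ≡ ∅
    S₂∩T = prove layout-equations (var 2F ∩' (var 3F ∪' var 4F)) ∅' env (layout-holds L [])

  private
    -- Solving the dual rank formulas of M and Ma for the dual rank y of a listed set.
    listing-arithmetic : ∀ y t a s g u v f y' →
      y + (t + a + s) ≡ (g + u + v) + (f + t + s) → y' + a ≡ g + f → y ≡ y' + u + v
    listing-arithmetic y t a s g u v f y' dual-M dual-Ma = +-cancelʳ-≡ (t + a + s) y (y' + u + v) (begin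
      y + (t + a + s)               ≡⟨ dual-M ⟩
      (g + u + v) + (f + t + s)     ≡⟨ regroup₁ g u v f t s ⟩
      (g + f) + (u + v + t + s)     ≡⟨ cong (λ z → z + (u + v + t + s)) dual-Ma ⟨
      (y' + a) + (u + v + t + s)    ≡⟨ regroup₂ y' a u v t s ⟩
      (y' + u + v) + (t + a + s)    ∎)
      where
      regroup₁ : ∀ g u v f t s → (g + u + v) + (f + t + s) ≡ (g + f) + (u + v + t + s)
      regroup₁ = solve-∀
      regroup₂ : ∀ y' a u v t s → (y' + a) + (u + v + t + s) ≡ (y' + u + v) + (t + a + s)
      regroup₂ = solve-∀

  -- One of the two symmetric halves of the construction.  Here Ma is the
  -- matroid on Sa = ground Ma with attached set Ta, and Sb, Sb' ⊆ Sb, Tb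
  -- belong to the other half.  M_k lists F ∪ Ta ∪ Sb' for F ∈ Z'(Ma); its
  -- dual should list G ∪ Tb ∪ (Sb − Sb') for G ∈ Z'(Ma*).
  module Half {n} {M Ma : RankFn n} (isM : IsMatroid M) (isMa : IsMatroid Ma)
              {Sb Sb' Ta Tb : Subset n} (L : Layout (ground M) (ground Ma) Sb Ta Tb) (Sb'⊆Sb : Sb' ⊆ Sb) where

    private
      E  = ground M
      Sa = ground Ma
      module DM = Duality M isM
      module DMa = Duality Ma isMa

    listed : Subset n → Subset n
    listed F = F ∪ Ta ∪ Sb'

    listed* : Subset n → Subset n
    listed* G = G ∪ Tb ∪ (Sb ─ Sb')

    listed-complement : ∀ {F} → F ⊆ Sa → E ─ listed F ≡ listed* (Sa ─ F)
    listed-complement {F} F⊆Sa =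
      prove ((var 5F ─' var 2F , ∅') ∷ (var 6F ─' var 1F , ∅') ∷ layout-equations)
        (var 0F ─' (var 6F ∪' var 3F ∪' var 5F)) ((var 1F ─' var 6F) ∪' var 4F ∪' (var 2F ─' var 5F))
        (E ∷ Sa ∷ Sb ∷ Ta ∷ Tb ∷ Sb' ∷ F ∷ []) (⊆⇒─≡∅ Sb'⊆Sb , ⊆⇒─≡∅ F⊆Sa , layout-holds L (Sb' ∷ F ∷ []))

    listed*-card : ∀ {G} → G ⊆ Sa → ∣ listed* G ∣ ≡ ∣ G ∣ + ∣ Tb ∣ + ∣ Sb ─ Sb' ∣
    listed*-card {G} G⊆Sa = begin
      ∣ G ∪ Tb ∪ (Sb ─ Sb') ∣             ≡⟨ card-∪-disjoint G _ G∩[Tb∪[Sb─Sb']] ⟩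
      ∣ G ∣ + ∣ Tb ∪ (Sb ─ Sb') ∣         ≡⟨ cong (λ t → ∣ G ∣ + t) (card-∪-disjoint Tb _ Tb∩[Sb─Sb']) ⟩
      ∣ G ∣ + (∣ Tb ∣ + ∣ Sb ─ Sb' ∣)     ≡⟨ +-assoc ∣ G ∣ ∣ Tb ∣ _ ⟨
      ∣ G ∣ + ∣ Tb ∣ + ∣ Sb ─ Sb' ∣       ∎
      where
      env = E ∷ Sa ∷ Sb ∷ Ta ∷ Tb ∷ Sb' ∷ G ∷ []
      hyps = (var 6F ─' var 1F , ∅') ∷ layout-equations
      hyps✓ = ⊆⇒─≡∅ G⊆Sa , layout-holds L (Sb' ∷ G ∷ [])
      G∩[Tb∪[Sb─Sb']] : G ∩ (Tb ∪ (Sb ─ Sb')) ≡ ∅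
      G∩[Tb∪[Sb─Sb']] = prove hyps (var 6F ∩' (var 4F ∪' (var 2F ─' var 5F))) ∅' env hyps✓
      Tb∩[Sb─Sb'] : Tb ∩ (Sb ─ Sb') ≡ ∅
      Tb∩[Sb─Sb'] = prove hyps (var 4F ∩' (var 2F ─' var 5F)) ∅' env hyps✓

    classify : ∀ {Y F} → CyclicFlat (dual M) Y → NPCyclicFlat Ma F → E ─ Y ≡ listed F →
               ∃ λ G → NPCyclicFlat (dual Ma) G × Y ≡ listed* G
    classify {Y} {F} cfY npF E─Y≡listedF =
      Sa ─ F , DMa.nonemptyProper-dual npF ,
      trans (complement-swap (DM.D.cyclicFlat⇒⊆ cfY) E─Y≡listedF) (listed-complement (proj₁ (proj₁ (proj₁ npF))))

    listing : rk M E ≡ ∣ Ta ∣ + r Ma + ∣ Sb' ∣ →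
      (∀ F → NPCyclicFlat Ma F → CyclicFlat M (listed F) × rk M (listed F) ≡ rk Ma F + ∣ Ta ∣ + ∣ Sb' ∣) →
      ∀ G → NPCyclicFlat (dual Ma) G →
      CyclicFlat (dual M) (listed* G) × rk (dual M) (listed* G) ≡ rk (dual Ma) G + ∣ Tb ∣ + ∣ Sb ─ Sb' ∣
    listing rank-E listed-M G npG = subst (CyclicFlat (dual M)) E─listedF≡ (DM.cyclicFlat-dual cfF) , rank
      where
      G⊆Sa : G ⊆ Sa
      G⊆Sa = proj₁ (proj₁ (proj₁ npG))
      F = Sa ─ G
      cfF = proj₁ (listed-M F (DMa.nonemptyProper-undual npG))
      rankF = Data.Product.proj₂ (listed-M F (DMa.nonemptyProper-undual npG))
      E─listedF≡ : E ─ listed F ≡ listed* G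
      E─listedF≡ = trans (listed-complement (p─q⊆p Sa G)) (cong listed* (complement-involutive G⊆Sa))
      listedF⊆E : listed F ⊆ E
      listedF⊆E = MatroidRank.cyclicFlat⇒⊆ M isM cfF
      listed*G⊆E : listed* G ⊆ E
      listed*G⊆E = subst (_⊆ E) E─listedF≡ (p─q⊆p E (listed F))
      E─listed*G≡ : E ─ listed* G ≡ listed F
      E─listed*G≡ = trans (cong (E ─_) (sym E─listedF≡)) (complement-involutive listedF⊆E)
      rank : rk (dual M) (listed* G) ≡ rk (dual Ma) G + ∣ Tb ∣ + ∣ Sb ─ Sb' ∣
      rank = listing-arithmetic (rk (dual M) (listed* G)) (∣ Ta ∣) (r Ma) (∣ Sb' ∣) (∣ G ∣) (∣ Tb ∣) (∣ Sb ─ Sb' ∣)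
                                (rk Ma F) (rk (dual Ma) G)
        (begin
          rk (dual M) (listed* G) + (∣ Ta ∣ + r Ma + ∣ Sb' ∣) ≡⟨ cong (λ t → rk (dual M) (listed* G) + t) rank-E ⟨
          rk (dual M) (listed* G) + rk M E                    ≡⟨ DM.dual-rank listed*G⊆E ⟩
          ∣ listed* G ∣ + rk M (E ─ listed* G)                ≡⟨ cong₂ _+_ (listed*-card G⊆Sa) (trans (cong (rk M) E─listed*G≡) rankF) ⟩
          (∣ G ∣ + ∣ Tb ∣ + ∣ Sb ─ Sb' ∣) + (rk Ma F + ∣ Ta ∣ + ∣ Sb' ∣) ∎)
        (DMa.dual-rank G⊆Sa)

open import Data.Nat using (ℕ; _+_; _<_)
open import Data.Fin.Subset using (Subset; _⊆_; _∪_; _─_; ∣_∣)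
open import Data.Integer using (ℤ; +_; _-_; _≤_)
open import Data.Product using (_×_)
open import Function.Bundles using (_⇔_)
open import Relation.Binary.PropositionalEquality using (_≡_)
import Data.Nat.Properties as ℕ
import Data.Integer as ℤ
import Data.Integer.Properties as ℤ
open import Data.Integer.Tactic.RingSolver using (solve-∀)
open import Data.Fin.Patterns using (0F; 1F; 2F; 3F; 4F)
open import Data.Vec using ([]; _∷_)
open import Data.Fin.Subset using () renaming (⊥ to ∅)
open import Data.Fin.Subset.Properties using (Empty-unique; p─⊥≡p)
open import Data.Product using (∃; _,_)
open import Data.Sum using (_⊎_; inj₁; inj₂)
open import Function.Bundles using (mk⇔)
open import Relation.Binary.PropositionalEquality using (sym; trans; cong; cong₂; subst; module ≡-Reasoning)
open SubsetSolver
open SubsetFacts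
open ConstructionDuality

+-difference : ∀ {x y z : ℕ} → x + y ≡ z → + x ≡ + z - + y
+-difference {x} {y} {z} x+y≡z = begin
  + x                   ≡⟨ cancel (+ x) (+ y) ⟨
  (+ x ℤ.+ + y) - + y   ≡⟨ cong (_- + y) (ℤ.pos-+ x y) ⟨
  + (x + y) - + y       ≡⟨ cong (λ t → + t - + y) x+y≡z ⟩
  + z - + y             ∎
  where
  open ≡-Reasoning
  cancel : ∀ a b → (a ℤ.+ b) - b ≡ a
  cancel = solve-∀

+-sum₄ : ∀ a b c d → + (a + b + c + d) ≡ + a ℤ.+ + b ℤ.+ + c ℤ.+ + d
+-sum₄ a b c d = trans (ℤ.pos-+ (a + b + c) d)
  (cong (ℤ._+ + d) (trans (ℤ.pos-+ (a + b) c) (cong (ℤ._+ + c) (ℤ.pos-+ a b))))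

rank-from-cardinality : ∀ {t a c R : ℕ} {k : ℤ} → + t ≡ k - + a - + c → + R ≡ k → R ≡ t + a + c
rank-from-cardinality {t} {a} {c} {R} {k} |T| rank = ℤ.+-injective (begin
  + R                         ≡⟨ rank ⟩
  k                           ≡⟨ cancel k (+ a) (+ c) ⟨
  (k - + a - + c) ℤ.+ + a ℤ.+ + c ≡⟨ cong (λ z → z ℤ.+ + a ℤ.+ + c) |T| ⟨
  + t ℤ.+ + a ℤ.+ + c         ≡⟨ cong (ℤ._+ + c) (ℤ.pos-+ t a) ⟨
  + (t + a) ℤ.+ + c           ≡⟨ ℤ.pos-+ (t + a) c ⟨
  + (t + a + c)               ∎)
  where
  open ≡-Reasoning
  cancel : ∀ k a c → (k - a - c) ℤ.+ a ℤ.+ c ≡ k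
  cancel = solve-∀

≤-with-equal-slack : ∀ {a b c d : ℤ} → b - a ≡ d - c → (a ≤ b) ⇔ (c ≤ d)
≤-with-equal-slack slack = mk⇔
  (λ a≤b → ℤ.0≤i-j⇒j≤i (subst (ℤ.0ℤ ≤_) slack (ℤ.i≤j⇒0≤j-i a≤b)))
  (λ c≤d → ℤ.0≤i-j⇒j≤i (subst (ℤ.0ℤ ≤_) (sym slack) (ℤ.i≤j⇒0≤j-i c≤d)))

dual-of-Mk : ∀ {n} {M₁ M₂ M : RankFn n} {S₁' S₂' T₁ T₂ : Subset n} {k : ℤ} →
  IsMatroid M₁ → IsMatroid M₂ → IsMatroid M →
  Disjoint (ground M₁) (ground M₂) → S₁' ⊆ ground M₁ → S₂' ⊆ ground M₂ →
  Disjoint T₁ T₂ → Disjoint T₁ (ground M₁ ∪ ground M₂) → Disjoint T₂ (ground M₁ ∪ ground M₂) →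
  + ∣ T₁ ∣ ≡ k - + r M₁ - + ∣ S₂' ∣ → + ∣ T₂ ∣ ≡ k - + r M₂ - + ∣ S₁' ∣ →
  IsMk k M₁ S₁' T₁ M₂ S₂' T₂ M →
  IsMk (+ (∣ ground M₁ ∣ + ∣ ground M₂ ∣ + ∣ T₁ ∣ + ∣ T₂ ∣) - k)
       (dual M₁) (ground M₁ ─ S₁') T₂ (dual M₂) (ground M₂ ─ S₂') T₁ (dual M)
dual-of-Mk {n} {M₁} {M₂} {M} {S₁'} {S₂'} {T₁} {T₂} {k}
  isM₁ isM₂ isM S₁∩S₂ S₁'⊆S₁ S₂'⊆S₂ T₁∩T₂ T₁∩S T₂∩S |T₁| |T₂|
  (E≡ , classification , (cf-∅ , _) , (cf-E , rank-E) , listed₁ , listed₂) =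
  E≡E* , classification* , (cf*-∅ , DM.D.ρ-∅) , (cf*-E , rank*-E) ,
  Half₁.listing rank₁ listed₁ , Half₂.listing rank₂ listed₂
  where
  open ≡-Reasoning
  S₁ = ground M₁
  S₂ = ground M₂
  E  = ground M
  E* = S₁ ∪ S₂ ∪ T₂ ∪ T₁
  module DM = Duality M isM

  L : Layout E S₁ S₂ T₁ T₂
  L = record { cover = E≡ ; S₁∩S₂ = Empty-unique S₁∩S₂ ; T₁∩T₂ = Empty-unique T₁∩T₂
             ; T₁∩S = Empty-unique T₁∩S ; T₂∩S = Empty-unique T₂∩S }

  module Half₁ = Half isM isM₁ L S₂'⊆S₂
  module Half₂ = Half isM isM₂ (swap L) S₁'⊆S₁

  env = E ∷ S₁ ∷ S₂ ∷ T₁ ∷ T₂ ∷ []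

  E≡E* : E ≡ E*
  E≡E* = prove layout-equations (var 0F) (var 1F ∪' var 2F ∪' var 4F ∪' var 3F) env (layout-holds L [])

  E─E≡∅ : E ─ (S₁ ∪ S₂ ∪ T₁ ∪ T₂) ≡ ∅
  E─E≡∅ = prove layout-equations (var 0F ─' (var 1F ∪' var 2F ∪' var 3F ∪' var 4F)) ∅' env (layout-holds L [])

  rank-M : + rk M E ≡ k
  rank-M = trans (cong (λ X → + rk M X) E≡) rank-E

  rank₁ : rk M E ≡ ∣ T₁ ∣ + r M₁ + ∣ S₂' ∣
  rank₁ = rank-from-cardinality |T₁| rank-M

  rank₂ : rk M E ≡ ∣ T₂ ∣ + r M₂ + ∣ S₁' ∣
  rank₂ = rank-from-cardinality |T₂| rank-M

  cf*-∅ : CyclicFlat (dual M) ∅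
  cf*-∅ = subst (CyclicFlat (dual M)) E─E≡∅ (DM.cyclicFlat-dual cf-E)

  cf*-E : CyclicFlat (dual M) E*
  cf*-E = subst (CyclicFlat (dual M)) (trans (p─⊥≡p E) E≡E*) (DM.cyclicFlat-dual cf-∅)

  rank*-E : + rk (dual M) E* ≡ + (∣ S₁ ∣ + ∣ S₂ ∣ + ∣ T₁ ∣ + ∣ T₂ ∣) - k
  rank*-E = begin
    + rk (dual M) E*                                  ≡⟨ cong (λ X → + rk (dual M) X) E≡E* ⟨
    + r (dual M)                                      ≡⟨ +-difference (trans DM.dual-rank-total (layout-card L)) ⟩
    + (∣ S₁ ∣ + ∣ S₂ ∣ + ∣ T₁ ∣ + ∣ T₂ ∣) - + r M     ≡⟨ cong (λ z → + (∣ S₁ ∣ + ∣ S₂ ∣ + ∣ T₁ ∣ + ∣ T₂ ∣) - z) rank-M ⟩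
    + (∣ S₁ ∣ + ∣ S₂ ∣ + ∣ T₁ ∣ + ∣ T₂ ∣) - k         ∎

  -- Every cyclic flat of M* is the complement of a cyclic flat of M_k,
  -- hence one of the listed sets.
  classification* : ∀ Y → CyclicFlat (dual M) Y →
    Y ≡ ∅ ⊎ Y ≡ E* ⊎
    (∃ λ G → NPCyclicFlat (dual M₁) G × Y ≡ Half₁.listed* G) ⊎
    (∃ λ G → NPCyclicFlat (dual M₂) G × Y ≡ Half₂.listed* G)
  classification* Y cfY with classification (E ─ Y) (DM.cyclicFlat-undual cfY)
  ... | inj₁ E─Y≡∅ =
    inj₂ (inj₁ (trans (complement-swap (DM.D.cyclicFlat⇒⊆ cfY) E─Y≡∅) (trans (p─⊥≡p E) E≡E*)))
  ... | inj₂ (inj₁ E─Y≡E) =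
    inj₁ (trans (complement-swap (DM.D.cyclicFlat⇒⊆ cfY) E─Y≡E) E─E≡∅)
  ... | inj₂ (inj₂ (inj₁ (F , npF , E─Y≡listed))) = inj₂ (inj₂ (inj₁ (Half₁.classify cfY npF E─Y≡listed)))
  ... | inj₂ (inj₂ (inj₂ (F , npF , E─Y≡listed))) = inj₂ (inj₂ (inj₂ (Half₂.classify cfY npF E─Y≡listed)))

dual-bound-term : ∀ {n} {M : RankFn n} {S' : Subset n} → IsMatroid M → S' ⊆ ground M →
                  + (r (dual M) + η (dual M) (ground M ─ S')) ≡ + ∣ ground M ∣ - + rk M S'
dual-bound-term {M = M} {S'} isM S'⊆S = +-difference (begin
  r (dual M) + η (dual M) (ground M ─ S') + rk M S'   ≡⟨ ℕ.+-assoc (r (dual M)) _ _ ⟩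
  r (dual M) + (η (dual M) (ground M ─ S') + rk M S') ≡⟨ cong (λ t → r (dual M) + t) (dual-nullity S'⊆S) ⟩
  r (dual M) + r M                                    ≡⟨ dual-rank-total ⟩
  ∣ ground M ∣                                        ∎)
  where
  open ≡-Reasoning
  open Duality M isM

bound-term : ∀ {n} {M : RankFn n} {S' : Subset n} → IsMatroid M → S' ⊆ ground M →
             + (r M + η M S') ≡ + r M ℤ.+ + ∣ S' ∣ - + rk M S'
bound-term {M = M} {S'} isM S'⊆S = trans
  (+-difference (trans (ℕ.+-assoc (r M) _ _) (cong (λ t → r M + t) (MatroidRank.nullity-rank M isM S'⊆S))))
  (cong (_- + rk M S') (ℤ.pos-+ (r M) ∣ S' ∣))

-- The bound on j for M_j(M₁*, …) holds exactly when the bound on k for M_k(M₁, …) does: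
-- both inequalities have the same slack.
bound-equivalence : ∀ {n} {M₁ M₂ : RankFn n} {S₁' S₂' T₁ T₂ : Subset n} {k : ℤ} →
  IsMatroid M₁ → IsMatroid M₂ → S₁' ⊆ ground M₁ → S₂' ⊆ ground M₂ →
  + ∣ T₁ ∣ ≡ k - + r M₁ - + ∣ S₂' ∣ → + ∣ T₂ ∣ ≡ k - + r M₂ - + ∣ S₁' ∣ →
  (+ (r (dual M₁) + η (dual M₁) (ground M₁ ─ S₁') + r (dual M₂) + η (dual M₂) (ground M₂ ─ S₂'))
     ≤ + (∣ ground M₁ ∣ + ∣ ground M₂ ∣ + ∣ T₁ ∣ + ∣ T₂ ∣) - k)
  ⇔ (+ (r M₁ + η M₁ S₁' + r M₂ + η M₂ S₂') ≤ k)
bound-equivalence {M₁ = M₁} {M₂} {S₁'} {S₂'} {T₁} {T₂} {k} isM₁ isM₂ S₁'⊆S₁ S₂'⊆S₂ |T₁| |T₂| =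
  ≤-with-equal-slack (begin
    j - + A
      ≡⟨ cong₂ _-_ j≡ A≡ ⟩
    (s₁ ℤ.+ s₂ ℤ.+ (k - r₁ - c₂) ℤ.+ (k - r₂ - c₁) - k) - ((s₁ - a₁) ℤ.+ (s₂ - a₂))
      ≡⟨ equal-slack s₁ s₂ r₁ r₂ c₁ c₂ a₁ a₂ k ⟩
    k - ((r₁ ℤ.+ c₁ - a₁) ℤ.+ (r₂ ℤ.+ c₂ - a₂))
      ≡⟨ cong (k -_) B≡ ⟨
    k - + B ∎)
  where
  open ≡-Reasoning
  A = r (dual M₁) + η (dual M₁) (ground M₁ ─ S₁') + r (dual M₂) + η (dual M₂) (ground M₂ ─ S₂')
  B = r M₁ + η M₁ S₁' + r M₂ + η M₂ S₂'
  j = + (∣ ground M₁ ∣ + ∣ ground M₂ ∣ + ∣ T₁ ∣ + ∣ T₂ ∣) - k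
  s₁ = + ∣ ground M₁ ∣
  s₂ = + ∣ ground M₂ ∣
  r₁ = + r M₁
  r₂ = + r M₂
  c₁ = + ∣ S₁' ∣
  c₂ = + ∣ S₂' ∣
  a₁ = + rk M₁ S₁'
  a₂ = + rk M₂ S₂'

  pair-up : ∀ x y z w → + (x + y + z + w) ≡ + (x + y) ℤ.+ + (z + w)
  pair-up x y z w = trans (cong +_ (ℕ.+-assoc (x + y) z w)) (ℤ.pos-+ (x + y) (z + w))

  j≡ : j ≡ s₁ ℤ.+ s₂ ℤ.+ (k - r₁ - c₂) ℤ.+ (k - r₂ - c₁) - k
  j≡ = cong (_- k) (trans (+-sum₄ (∣ ground M₁ ∣) (∣ ground M₂ ∣) (∣ T₁ ∣) (∣ T₂ ∣)) (cong₂ (λ t₁ t₂ → s₁ ℤ.+ s₂ ℤ.+ t₁ ℤ.+ t₂) |T₁| |T₂|))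

  A≡ : + A ≡ (s₁ - a₁) ℤ.+ (s₂ - a₂)
  A≡ = trans (pair-up (r (dual M₁)) (η (dual M₁) (ground M₁ ─ S₁')) (r (dual M₂)) (η (dual M₂) (ground M₂ ─ S₂'))) (cong₂ ℤ._+_ (dual-bound-term isM₁ S₁'⊆S₁) (dual-bound-term isM₂ S₂'⊆S₂))

  B≡ : + B ≡ (r₁ ℤ.+ c₁ - a₁) ℤ.+ (r₂ ℤ.+ c₂ - a₂)
  B≡ = trans (pair-up (r M₁) (η M₁ S₁') (r M₂) (η M₂ S₂')) (cong₂ ℤ._+_ (bound-term isM₁ S₁'⊆S₁) (bound-term isM₂ S₂'⊆S₂))

  equal-slack : ∀ s₁ s₂ r₁ r₂ c₁ c₂ a₁ a₂ k →
    (s₁ ℤ.+ s₂ ℤ.+ (k - r₁ - c₂) ℤ.+ (k - r₂ - c₁) - k) - ((s₁ - a₁) ℤ.+ (s₂ - a₂))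
      ≡ k - ((r₁ ℤ.+ c₁ - a₁) ℤ.+ (r₂ ℤ.+ c₂ - a₂))
  equal-slack = solve-∀

-- Theorem 3.2.  The positivity of r(M₁), r(M₂) is needed for M_k to exist,
-- not for the implications proved here.
theorem3p2 : ∀ {n : ℕ} (M₁ M₂ : RankFn n) (S₁' S₂' T₁ T₂ : Subset n) (k : ℤ) →
    IsMatroid M₁ → IsMatroid M₂ →
    0 < r M₁ → 0 < r M₂ →
    Disjoint (ground M₁) (ground M₂) →
    S₁' ⊆ ground M₁ → S₂' ⊆ ground M₂ →
    Disjoint T₁ T₂ →
    Disjoint T₁ (ground M₁ ∪ ground M₂) →
    Disjoint T₂ (ground M₁ ∪ ground M₂) →
    + ∣ T₁ ∣ ≡ k - + r M₁ - + ∣ S₂' ∣ →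
    + ∣ T₂ ∣ ≡ k - + r M₂ - + ∣ S₁' ∣ →
    let S₁ = ground M₁
        S₂ = ground M₂
        j = + (∣ S₁ ∣ + ∣ S₂ ∣ + ∣ T₁ ∣ + ∣ T₂ ∣) - k
    in ((+ (r (dual M₁) + η (dual M₁) (S₁ ─ S₁') + r (dual M₂) + η (dual M₂) (S₂ ─ S₂')) ≤ j)
         ⇔ (+ (r M₁ + η M₁ S₁' + r M₂ + η M₂ S₂') ≤ k))
       × ((+ (r M₁ + η M₁ S₁' + r M₂ + η M₂ S₂') ≤ k) →
          ∀ (M : RankFn n) → IsMatroid M →
          IsMk k M₁ S₁' T₁ M₂ S₂' T₂ M →
          IsMk j (dual M₁) (S₁ ─ S₁') T₂ (dual M₂) (S₂ ─ S₂') T₁ (dual M))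
theorem3p2 M₁ M₂ S₁' S₂' T₁ T₂ k isM₁ isM₂ _ _ S₁∩S₂ S₁'⊆S₁ S₂'⊆S₂ T₁∩T₂ T₁∩S T₂∩S |T₁| |T₂| =
  bound-equivalence {T₁ = T₁} {T₂} isM₁ isM₂ S₁'⊆S₁ S₂'⊆S₂ |T₁| |T₂| ,
  λ _ M isM Mk → dual-of-Mk isM₁ isM₂ isM S₁∩S₂ S₁'⊆S₁ S₂'⊆S₂ T₁∩T₂ T₁∩S T₂∩S |T₁| |T₂| Mk
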